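{- Let $q$ be a prime power, $n$ a positive integer, and let $\alpha\in \mathbb{F}_{q^{2n}}$ be such that $\mathbb{F}_{q^{2n}}=\mathbb{F}_q(\alpha)$. Let $N(\alpha,2,n;q)$ denote the number of ordered pairs $(v_1,v_2)\in \mathbb{F}_{q^{2n}}^2$ such that the ordered set $(v_1, v_2, \alpha v_1, \alpha v_2, \dots, \alpha^{n-1}v_1, \alpha^{n-1}v_2)$ is an $\mathbb{F}_q$-basis of $\mathbb{F}_{q^{2n}}$. Let $\nu$ denote the number of ordered pairs $(f_1,f_2)$ of nonzero polynomials in $\mathbb{F}_q[X]$, each of degree $<n$, with $f_2$ monic and $f_1,f_2$ relatively prime. Then $$N(\alpha,2,n;q)=\left(q^{2n}-\nu-1\right)\left(q^{2n}-1\right).$$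
   Context: $\mathbb{F}_q$ denotes the finite field with $q$ elements, and $\mathbb{F}_{q^{2n}}$ is regarded as a $2n$-dimensional vector space over $\mathbb{F}_q$. -}

module Defs where

open import Level using (0ℓ)
open import Data.Nat as ℕ using (ℕ; zero; suc)
open import Data.Nat.Primality using (Prime)
open import Data.Fin using (Fin; toℕ)
import Data.Fin as Fin
open import Data.Vec using (Vec)
import Data.Vec as Vec
open import Data.List using (List; []; _∷_)
import Data.List as List
open import Data.Product using (Σ; ∃; _×_; _,_)
open import Data.Empty using (⊥)
open import Relation.Nullary using (¬_)
open import Relation.Binary.PropositionalEquality using (_≡_)
open import Algebra.Bundles using (CommutativeRing; RawRing)
open import Algebra.Morphism.Structures using (IsRingHomomorphism)
import Algebra.Definitions.RawMonoid as RM

IsPrimePower : ℕ → Set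
IsPrimePower q = Σ ℕ λ p → Σ ℕ λ k → Prime p × (q ≡ p ℕ.^ suc k)

record Field : Set₁ where
  field
    commRing : CommutativeRing 0ℓ 0ℓ
  open CommutativeRing commRing public
  field
    1≉0     : ¬ (1# ≈ 0#)
    inverse : ∀ x → ¬ (x ≈ 0#) → Σ Carrier λ y → x * y ≈ 1#

HasCount : {A : Set} → (A → A → Set) → (A → Set) → ℕ → Set
HasCount {A} _≈_ P k =
  Σ (Vec A k) λ xs →
      (∀ i → P (Vec.lookup xs i))
    × (∀ i j → Vec.lookup xs i ≈ Vec.lookup xs j → i ≡ j)
    × (∀ x → P x → ∃ λ i → x ≈ Vec.lookup xs i)

HasCard : Field → ℕ → Set
HasCard F q = HasCount (Field._≈_ F) (λ _ → Data.Unit.⊤) q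
  where import Data.Unit

-- Field extensions L / K given by a ring homomorphism ι : K → L.

module Extension (K L : Field) (ι : Field.Carrier K → Field.Carrier L) where
  private
    module K = Field K
    module L = Field L

  record IsSubfieldOverK (S : L.Carrier → Set) : Set where
    field
      resp  : ∀ {x y} → x L.≈ y → S x → S y
      base  : ∀ c → S (ι c)
      +-cl  : ∀ {x y} → S x → S y → S (x L.+ y)
      *-cl  : ∀ {x y} → S x → S y → S (x L.* y)
      neg-cl : ∀ {x} → S x → S (L.- x)
      inv-cl : ∀ {x y} → S x → x L.* y L.≈ L.1# → S y

  -- L = K(α): the only subfield of L containing ι(K) and α is L itself.
  Generates : L.Carrier → Set₁
  Generates α = ∀ (S : L.Carrier → Set) → IsSubfieldOverK S → S α → ∀ x → S x

  lincomb : ∀ {m} → (Fin m → Fin 2 → K.Carrier) → (Fin m → Fin 2 → L.Carrier)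
          → L.Carrier
  lincomb c b = RM.sum L.+-rawMonoid (λ i → RM.sum L.+-rawMonoid
                  (λ j → ι (c i j) L.* b i j))

  IsBasis : ∀ {m} → (Fin m → Fin 2 → L.Carrier) → Set
  IsBasis b =
      (∀ c → lincomb c b L.≈ L.0# → ∀ i j → c i j K.≈ K.0#)
    × (∀ x → Σ _ λ c → lincomb c b L.≈ x)

  pow : L.Carrier → ℕ → L.Carrier
  pow x zero    = L.1#
  pow x (suc k) = x L.* pow x k

  -- The family (v₁, v₂, α v₁, α v₂, …, α^{n-1} v₁, α^{n-1} v₂),
  -- entry (i , j) being α^i v_{j+1}.
  family : (n : ℕ) → L.Carrier → L.Carrier → L.Carrier → Fin n → Fin 2 → L.Carrier
  family n α v₁ v₂ i Fin.zero    = pow α (toℕ i) L.* v₁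
  family n α v₁ v₂ i (Fin.suc _) = pow α (toℕ i) L.* v₂

  GoodPair : ℕ → L.Carrier → L.Carrier × L.Carrier → Set
  GoodPair n α (v₁ , v₂) = IsBasis (family n α v₁ v₂)

  PairEq : L.Carrier × L.Carrier → L.Carrier × L.Carrier → Set
  PairEq (a , b) (c , d) = (a L.≈ c) × (b L.≈ d)

-- Polynomials over a field K, as coefficient lists (constant term first).

module Poly (K : Field) where
  open Field K

  Pol : Set
  Pol = List Carrier

  coeff : Pol → ℕ → Carrier
  coeff []       _       = 0#
  coeff (a ∷ p)  zero    = a
  coeff (a ∷ p)  (suc i) = coeff p i

  _≈P_ : Pol → Pol → Set
  p ≈P r = ∀ i → coeff p i ≈ coeff r i

  _+P_ : Pol → Pol → Pol
  []      +P r       = r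
  (a ∷ p) +P []      = a ∷ p
  (a ∷ p) +P (b ∷ r) = (a + b) ∷ (p +P r)

  _*P_ : Pol → Pol → Pol
  []      *P r = []
  (a ∷ p) *P r = List.map (a *_) r +P (0# ∷ (p *P r))

  oneP : Pol
  oneP = 1# ∷ []

  _∣P_ : Pol → Pol → Set
  g ∣P f = Σ Pol λ h → (g *P h) ≈P f

  Coprime : Pol → Pol → Set
  Coprime f g = ∀ d → d ∣P f → d ∣P g → d ∣P oneP

  NonZeroP : Pol → Set
  NonZeroP p = ¬ (p ≈P [])

  Monic : Pol → Set
  Monic p = Σ ℕ λ d → (coeff p d ≈ 1#) × (∀ i → d ℕ.< i → coeff p i ≈ 0#)

  -- polynomials of degree < n, as coefficient vectors of length n
  toPol : ∀ {n} → Vec Carrier n → Pol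
  toPol = Vec.toList

  NuPair : ∀ {n} → Vec Carrier n × Vec Carrier n → Set
  NuPair (f₁ , f₂) = NonZeroP (toPol f₁) × NonZeroP (toPol f₂)
                   × Monic (toPol f₂) × Coprime (toPol f₁) (toPol f₂)

  VecPairEq : ∀ {n} → Vec Carrier n × Vec Carrier n → Vec Carrier n × Vec Carrier n → Set
  VecPairEq (f₁ , f₂) (g₁ , g₂) = (toPol f₁ ≈P toPol g₁) × (toPol f₂ ≈P toPol g₂)

-- Write y = v₁ / v₂. Since α has degree 2n over K, no nonzero polynomial of degree < 2n vanishes at α.
-- Hence a dependence u₀(α) v₁ + u₁(α) v₂ = 0 with u₀, u₁ of degree < n exhibits y = -u₁(α)/u₀(α) as a
-- ratio of two such polynomials, and conversely; and since both sides have q^(2n) elements, an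
-- independent family of 2n vectors spans. So (v₁ , v₂) is good iff v₂ ≠ 0 and y is not exceptional,
-- i.e. neither 0 nor such a ratio. Among the representations of a ratio, one with a denominator of least
-- degree divides every other by long division; so each ratio has exactly one reduced representative
-- (f₁ , f₂), coprime with f₂ monic, and there are 1 + ν exceptional values. Counting the pairs (v₂ , y)
-- gives (q^(2n) - 1)(q^(2n) - 1 - ν).
module Submission where

open import Defs
open import Level using (0ℓ)
open import Algebra.Bundles using (CommutativeRing)
open import Data.Nat as ℕ using (ℕ; zero; suc; _≤_; _<_; z≤n; s≤s; _^_; _∸_)
import Data.Nat.Properties as ℕP
open import Data.Integer as ℤ using (ℤ; +_; -[1+_]; _⊖_)
import Data.Integer.Properties as ℤP
open import Data.Sign as Sign using (Sign)
open import Data.Maybe using (Maybe; just; nothing)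
open import Data.Fin as Fin using (Fin; zero; suc; toℕ)
import Data.Fin.Properties as FinP
open import Data.Vec as Vec using (Vec; []; _∷_; lookup; tabulate)
import Data.Vec.Properties as VecP
open import Data.List as List using (List; []; _∷_)
open import Data.Product using (Σ; ∃; _×_; _,_; proj₁; proj₂)
open import Data.Product.Relation.Binary.Pointwise.NonDependent using (Pointwise; ×-isEquivalence)
open import Data.Sum using (_⊎_; inj₁; inj₂)
open import Data.Empty using (⊥; ⊥-elim)
open import Data.Unit using (⊤; tt)
open import Function using (Injective)
open import Relation.Nullary using (yes; no; ¬_; Dec)
open import Relation.Nullary.Decidable using (_×-dec_; ¬?)
open import Relation.Binary using (Rel; IsEquivalence)
open import Relation.Binary.PropositionalEquality as ≡ using (_≡_)
open import Algebra.Morphism.Structures using (module RingMorphisms)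
import Algebra.Solver.Ring.AlmostCommutativeRing as ACR

-- The ring solver with integer coefficients cast into R, so that normal forms are compared by computation.
module IntegerCoefficientSolver (R : CommutativeRing 0ℓ 0ℓ) where
  open CommutativeRing R
  open import Algebra.Properties.Ring ring
    using (-‿distribˡ-*; -‿involutive; -0#≈0#; -‿+-comm; -1*x≈-x)
  open import Algebra.Properties.Semiring.Mult semiring
    using (×-homo-+; ×1-homo-*) renaming (_×_ to _·_)
  import Algebra.Properties.CommutativeSemigroup *-commutativeSemigroup as CSP
  open import Relation.Binary.Reasoning.Setoid setoid

  cast : ℤ → Carrier
  cast (+ n)    = n · 1#
  cast -[1+ n ] = - (suc n · 1#)

  cast-⊖ : ∀ m n → cast (m ⊖ n) ≈ m · 1# - n · 1#
  cast-⊖ zero    zero    = sym (trans (+-congˡ -0#≈0#) (+-identityʳ _))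
  cast-⊖ zero    (suc n) = sym (+-identityˡ _)
  cast-⊖ (suc m) zero    = sym (trans (+-congˡ -0#≈0#) (+-identityʳ _))
  cast-⊖ (suc m) (suc n) rewrite ℤP.[1+m]⊖[1+n]≡m⊖n m n = begin
    cast (m ⊖ n)                   ≈⟨ cast-⊖ m n ⟩
    a - b                          ≈⟨ +-identityˡ (a - b) ⟨
    0# + (a - b)                   ≈⟨ +-congʳ (-‿inverseʳ 1#) ⟨
    (1# - 1#) + (a - b)            ≈⟨ +-assoc 1# (- 1#) (a - b) ⟩
    1# + (- 1# + (a - b))          ≈⟨ +-congˡ (+-assoc (- 1#) a (- b)) ⟨
    1# + ((- 1# + a) - b)          ≈⟨ +-congˡ (+-congʳ (+-comm (- 1#) a)) ⟩
    1# + ((a - 1#) - b)            ≈⟨ +-congˡ (+-assoc a (- 1#) (- b)) ⟩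
    1# + (a + (- 1# - b))          ≈⟨ +-congˡ (+-congˡ (-‿+-comm 1# b)) ⟩
    1# + (a - (1# + b))            ≈⟨ +-assoc 1# a (- (1# + b)) ⟨
    (1# + a) - (1# + b)            ∎
    where a = m · 1#; b = n · 1#

  cast-+ : ∀ i j → cast (i ℤ.+ j) ≈ cast i + cast j
  cast-+ (+ m)    (+ n)    = ×-homo-+ 1# m n
  cast-+ (+ m)    -[1+ n ] = cast-⊖ m (suc n)
  cast-+ -[1+ m ] (+ n)    = trans (cast-⊖ n (suc m)) (+-comm _ _)
  cast-+ -[1+ m ] -[1+ n ] = begin
    - (suc (suc (m ℕ.+ n)) · 1#)       ≡⟨ ≡.cong (λ k → - (suc k · 1#)) (ℕP.+-suc m n) ⟨
    - ((suc m ℕ.+ suc n) · 1#)         ≈⟨ -‿cong (×-homo-+ 1# (suc m) (suc n)) ⟩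
    - (suc m · 1# + suc n · 1#)        ≈⟨ -‿+-comm _ _ ⟨
    - (suc m · 1#) - (suc n · 1#)      ∎

  cast-neg : ∀ i → cast (ℤ.- i) ≈ - cast i
  cast-neg (+ zero)  = sym -0#≈0#
  cast-neg (+ suc n) = refl
  cast-neg -[1+ n ]  = sym (-‿involutive _)

  sign : Sign → Carrier
  sign Sign.+ = 1#
  sign Sign.- = - 1#

  sign-* : ∀ s t → sign (s Sign.* t) ≈ sign s * sign t
  sign-* Sign.+ t      = sym (*-identityˡ _)
  sign-* Sign.- Sign.+ = sym (*-identityʳ _)
  sign-* Sign.- Sign.- = trans (sym (-‿involutive 1#)) (sym (-1*x≈-x (- 1#)))

  cast-◃ : ∀ s n → cast (s ℤ.◃ n) ≈ sign s * (n · 1#)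
  cast-◃ s       zero    = sym (zeroʳ _)
  cast-◃ Sign.+ (suc n) = sym (*-identityˡ _)
  cast-◃ Sign.- (suc n) = trans (-‿cong (sym (*-identityˡ _))) (-‿distribˡ-* _ _)

  cast-sign*abs : ∀ i → cast i ≈ sign (ℤ.sign i) * (ℤ.∣ i ∣ · 1#)
  cast-sign*abs (+ n)    = sym (*-identityˡ _)
  cast-sign*abs -[1+ n ] = trans (-‿cong (sym (*-identityˡ _))) (-‿distribˡ-* _ _)

  cast-* : ∀ i j → cast (i ℤ.* j) ≈ cast i * cast j
  cast-* i j = begin
    cast (i ℤ.* j)                               ≈⟨ cast-◃ (ℤ.sign i Sign.* ℤ.sign j) (ℤ.∣ i ∣ ℕ.* ℤ.∣ j ∣) ⟩
    sign (si Sign.* sj) * ((ℤ.∣ i ∣ ℕ.* ℤ.∣ j ∣) · 1#) ≈⟨ *-cong (sign-* si sj) (×1-homo-* ℤ.∣ i ∣ ℤ.∣ j ∣) ⟩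
    (sign si * sign sj) * (a * b)               ≈⟨ CSP.interchange (sign si) (sign sj) a b ⟩
    (sign si * a) * (sign sj * b)               ≈⟨ *-cong (cast-sign*abs i) (cast-sign*abs j) ⟨
    cast i * cast j                              ∎
    where
    si = ℤ.sign i; sj = ℤ.sign j; a = ℤ.∣ i ∣ · 1#; b = ℤ.∣ j ∣ · 1#

  cast-morphism : ℤ.+-*-rawRing ACR.-Raw-AlmostCommutative⟶ ACR.fromCommutativeRing R
  cast-morphism = record
    { ⟦_⟧ = cast ; +-homo = cast-+ ; *-homo = cast-* ; -‿homo = cast-neg
    ; 0-homo = refl ; 1-homo = +-identityʳ 1# }

  cast-equal? : ∀ i j → Maybe (cast i ≈ cast j)
  cast-equal? i j with i ℤ.≟ j
  ... | yes ≡.refl = just refl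
  ... | no _       = nothing

  open import Algebra.Solver.Ring ℤ.+-*-rawRing (ACR.fromCommutativeRing R) cast-morphism cast-equal? public

record FinPartition {m} (Q : Fin m → Set) : Set where
  field
    #sat #unsat     : ℕ
    sat             : Fin #sat → Fin m
    unsat           : Fin #unsat → Fin m
    size            : #sat ℕ.+ #unsat ≡ m
    sat-holds       : ∀ k → Q (sat k)
    unsat-fails     : ∀ k → ¬ Q (unsat k)
    sat-injective   : Injective _≡_ _≡_ sat
    unsat-injective : Injective _≡_ _≡_ unsat
    covers          : ∀ i → (∃ λ k → sat k ≡ i) ⊎ (∃ λ k → unsat k ≡ i)

module _ where
  private
    zero∷suc : ∀ {a m} → (Fin a → Fin m) → Fin (suc a) → Fin (suc m)
    zero∷suc f zero    = zero
    zero∷suc f (suc k) = suc (f k)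

    zero∷suc-injective : ∀ {a m} {f : Fin a → Fin m} → Injective _≡_ _≡_ f
                       → Injective _≡_ _≡_ (zero∷suc f)
    zero∷suc-injective inj {zero}  {zero}  _ = ≡.refl
    zero∷suc-injective inj {suc k} {suc l} e = ≡.cong suc (inj (FinP.suc-injective e))

    suc∘-injective : ∀ {a m} {f : Fin a → Fin m} → Injective _≡_ _≡_ f
                   → Injective _≡_ _≡_ (λ k → suc (f k))
    suc∘-injective inj e = inj (FinP.suc-injective e)

  finPartition : ∀ {m} {Q : Fin m → Set} → (∀ i → Dec (Q i)) → FinPartition Q
  finPartition {zero} Q? = record
    { #sat = 0 ; #unsat = 0 ; sat = λ () ; unsat = λ () ; size = ≡.refl
    ; sat-holds = λ () ; unsat-fails = λ () ; sat-injective = λ {} ; unsat-injective = λ {}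
    ; covers = λ () }
  finPartition {suc m} {Q} Q? with finPartition (λ i → Q? (suc i)) | Q? zero
  ... | P | yes q = record
    { #sat = suc #sat ; #unsat = #unsat ; sat = zero∷suc sat ; unsat = λ k → suc (unsat k)
    ; size = ≡.cong suc size
    ; sat-holds = λ { zero → q ; (suc k) → sat-holds k } ; unsat-fails = unsat-fails
    ; sat-injective = zero∷suc-injective sat-injective ; unsat-injective = suc∘-injective unsat-injective
    ; covers = λ { zero → inj₁ (zero , ≡.refl) ; (suc i) → cover-suc i } }
    where
    open FinPartition P
    cover-suc : ∀ i → (∃ λ k → zero∷suc sat k ≡ suc i) ⊎ (∃ λ k → suc (unsat k) ≡ suc i)
    cover-suc i with covers i
    ... | inj₁ (k , e) = inj₁ (suc k , ≡.cong suc e)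
    ... | inj₂ (k , e) = inj₂ (k , ≡.cong suc e)
  ... | P | no ¬q = record
    { #sat = #sat ; #unsat = suc #unsat ; sat = λ k → suc (sat k) ; unsat = zero∷suc unsat
    ; size = ≡.trans (ℕP.+-suc #sat #unsat) (≡.cong suc size)
    ; sat-holds = sat-holds ; unsat-fails = λ { zero → ¬q ; (suc k) → unsat-fails k }
    ; sat-injective = suc∘-injective sat-injective ; unsat-injective = zero∷suc-injective unsat-injective
    ; covers = λ { zero → inj₂ (zero , ≡.refl) ; (suc i) → cover-suc i } }
    where
    open FinPartition P
    cover-suc : ∀ i → (∃ λ k → suc (sat k) ≡ suc i) ⊎ (∃ λ k → zero∷suc unsat k ≡ suc i)
    cover-suc i with covers i
    ... | inj₁ (k , e) = inj₁ (k , ≡.cong suc e)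
    ... | inj₂ (k , e) = inj₂ (suc k , ≡.cong suc e)

Distinct : {A : Set} → Rel A 0ℓ → ∀ {k} → Vec A k → Set
Distinct _≈_ xs = ∀ i j → lookup xs i ≈ lookup xs j → i ≡ j

HasCount-× : ∀ {A B : Set} {_≈A_ : Rel A 0ℓ} {_≈B_ : Rel B 0ℓ} {U : A → Set} {V : B → Set} {a b}
           → HasCount _≈A_ U a → HasCount _≈B_ V b
           → HasCount (Pointwise _≈A_ _≈B_) (λ p → U (proj₁ p) × V (proj₂ p)) (a ℕ.* b)
HasCount-× {A} {B} {_≈A_} {_≈B_} {U} {V} {a} {b}
  (xs , xs-U , xs-distinct , xs-cover) (ys , ys-V , ys-distinct , ys-cover) =
  tabulate pair ,
  (λ k → ≡.subst (λ p → U (proj₁ p) × V (proj₂ p)) (≡.sym (lookup-pair k)) (xs-U _ , ys-V _)) ,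
  (λ k l e → distinct k l (≡.subst₂ _≈_ (lookup-pair k) (lookup-pair l) e)) ,
  λ { (x , y) (ux , vy) → cover x y (xs-cover x ux) (ys-cover y vy) }
  where
  _≈_ = Pointwise _≈A_ _≈B_
  pair : Fin (a ℕ.* b) → A × B
  pair k = lookup xs (proj₁ (Fin.remQuot {a} b k)) , lookup ys (proj₂ (Fin.remQuot {a} b k))
  lookup-pair : ∀ k → lookup (tabulate pair) k ≡ pair k
  lookup-pair = VecP.lookup∘tabulate pair
  distinct : ∀ k l → pair k ≈ pair l → k ≡ l
  distinct k l (e₁ , e₂) = begin
    k                                 ≡⟨ FinP.combine-remQuot {a} b k ⟨
    Fin.combine (quot k) (rem k)      ≡⟨ ≡.cong₂ Fin.combine (xs-distinct _ _ e₁) (ys-distinct _ _ e₂) ⟩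
    Fin.combine (quot l) (rem l)      ≡⟨ FinP.combine-remQuot {a} b l ⟩
    l                                 ∎
    where
    open ≡.≡-Reasoning
    quot : Fin (a ℕ.* b) → Fin a
    quot k = proj₁ (Fin.remQuot {a} b k)
    rem : Fin (a ℕ.* b) → Fin b
    rem k = proj₂ (Fin.remQuot {a} b k)
  cover : ∀ x y → (∃ λ i → x ≈A lookup xs i) → (∃ λ j → y ≈B lookup ys j)
        → ∃ λ k → (x , y) ≈ lookup (tabulate pair) k
  cover x y (i , x≈) (j , y≈) = Fin.combine i j ,
    ≡.subst ((x , y) ≈_) (≡.sym (lookup-pair (Fin.combine i j)))
      (≡.subst (λ r → (x , y) ≈ (lookup xs (proj₁ r) , lookup ys (proj₂ r)))
               (≡.sym (FinP.remQuot-combine {a} {b} i j)) (x≈ , y≈))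

HasCount-Fin : ∀ k → HasCount {Fin k} _≡_ (λ _ → ⊤) k
HasCount-Fin k = Vec.allFin k , (λ _ → tt) ,
  (λ i j e → ≡.trans (≡.sym (VecP.lookup-allFin i)) (≡.trans e (VecP.lookup-allFin j))) ,
  λ i _ → i , ≡.sym (VecP.lookup-allFin i)

module Counting {A : Set} (_≈_ : Rel A 0ℓ) (≈-equiv : IsEquivalence _≈_) where
  private module ≈ = IsEquivalence ≈-equiv

  distinct⇒≤count : ∀ {B : Set} {_≈B_ : Rel B 0ℓ} {P : B → Set} {U : A → Set} {a b} (xs : Vec B a)
                  → (∀ i → P (lookup xs i)) → Distinct _≈B_ xs → HasCount _≈_ U b
                  → (f : B → A) → (∀ x → P x → U (f x))
                  → (∀ x y → P x → P y → f x ≈ f y → x ≈B y) → a ≤ b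
  distinct⇒≤count xs xs-P xs-distinct (ys , _ , _ , ys-cover) f f-U f-injective =
    FinP.injective⇒≤ {f = index} index-injective
    where
    index-correct : ∀ i → Σ _ λ j → f (lookup xs i) ≈ lookup ys j
    index-correct i = ys-cover (f (lookup xs i)) (f-U _ (xs-P i))
    index : Fin _ → Fin _
    index i = proj₁ (index-correct i)
    index-injective : Injective _≡_ _≡_ index
    index-injective {i} {j} e = xs-distinct i j (f-injective _ _ (xs-P i) (xs-P j)
      (≈.trans (proj₂ (index-correct i))
        (≈.sym (≡.subst (λ k → f (lookup xs j) ≈ lookup ys k) (≡.sym e) (proj₂ (index-correct j))))))

  HasCount-map : ∀ {B : Set} {_≈B_ : Rel B 0ℓ} {P : B → Set} {U : A → Set} {a}
               → HasCount _≈B_ P a → (f : B → A)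
               → (∀ {x y} → x ≈B y → f x ≈ f y) → (∀ x → P x → U (f x))
               → (∀ x y → P x → P y → f x ≈ f y → x ≈B y)
               → (∀ y → U y → Σ B λ x → P x × f x ≈ y)
               → HasCount _≈_ U a
  HasCount-map {_≈B_ = _≈B_} {P} {U} (xs , xs-P , xs-distinct , xs-cover) f f-cong f-U f-injective f-onto =
    Vec.map f xs ,
    (λ i → ≡.subst U (≡.sym (lookup-map i)) (f-U _ (xs-P i))) ,
    (λ i j e → xs-distinct i j (f-injective _ _ (xs-P i) (xs-P j) (≡.subst₂ _≈_ (lookup-map i) (lookup-map j) e))) ,
    λ y uy → let (x , px , fx≈y) = f-onto y uy ; (i , x≈) = xs-cover x px in
      i , ≈.trans (≈.sym fx≈y) (≡.subst (f x ≈_) (≡.sym (lookup-map i)) (f-cong x≈))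
    where
    lookup-map : ∀ i → lookup (Vec.map f xs) i ≡ f (lookup xs i)
    lookup-map i = VecP.lookup-map i f xs

  HasCount-unique : ∀ {P : A → Set} {a b} → HasCount _≈_ P a → HasCount _≈_ P b → a ≡ b
  HasCount-unique ca@(xs , xs-P , xs-distinct , _) cb@(ys , ys-P , ys-distinct , _) =
    ℕP.≤-antisym (distinct⇒≤count xs xs-P xs-distinct cb (λ x → x) (λ _ p → p) (λ _ _ _ _ e → e))
                 (distinct⇒≤count ys ys-P ys-distinct ca (λ x → x) (λ _ p → p) (λ _ _ _ _ e → e))

  HasCount-⇔ : ∀ {P Q : A → Set} {a} → HasCount _≈_ P a
             → (∀ x → P x → Q x) → (∀ x → Q x → P x) → HasCount _≈_ Q a
  HasCount-⇔ (xs , xs-P , xs-distinct , xs-cover) P⇒Q Q⇒P =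
    xs , (λ i → P⇒Q _ (xs-P i)) , xs-distinct , λ x qx → xs-cover x (Q⇒P x qx)

  HasCount-singleton : (c : A) → HasCount _≈_ (_≈ c) 1
  HasCount-singleton c =
    c ∷ [] , (λ { zero → ≈.refl }) , (λ { zero zero _ → ≡.refl }) , λ x e → zero , e

  HasCount-reindex : ∀ {R : A → Set} {k m} (xs : Vec A m) → Distinct _≈_ xs
                   → (σ : Fin k → Fin m) → Injective _≡_ _≡_ σ
                   → (∀ j → R (lookup xs (σ j))) → (∀ x → R x → ∃ λ j → x ≈ lookup xs (σ j))
                   → HasCount _≈_ R k
  HasCount-reindex {R} xs xs-distinct σ σ-injective σ-R σ-cover =
    tabulate (λ j → lookup xs (σ j)) ,
    (λ j → ≡.subst R (≡.sym (lookup-σ j)) (σ-R j)) ,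
    (λ j l e → σ-injective (xs-distinct _ _ (≡.subst₂ _≈_ (lookup-σ j) (lookup-σ l) e))) ,
    λ x rx → let (j , x≈) = σ-cover x rx in j , ≡.subst (x ≈_) (≡.sym (lookup-σ j)) x≈
    where
    lookup-σ : ∀ j → lookup (tabulate (λ j → lookup xs (σ j))) j ≡ lookup xs (σ j)
    lookup-σ = VecP.lookup∘tabulate (λ j → lookup xs (σ j))

  HasCount-partition : ∀ {U P : A → Set} {m} → HasCount _≈_ U m → (∀ x → Dec (P x))
                     → (∀ {x y} → x ≈ y → P x → P y)
                     → Σ ℕ λ a → Σ ℕ λ b → HasCount _≈_ (λ x → U x × P x) a
                         × HasCount _≈_ (λ x → U x × ¬ P x) b × (a ℕ.+ b ≡ m)
  HasCount-partition {U} {P} (xs , xs-U , xs-distinct , xs-cover) P? P-resp =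
    #sat , #unsat ,
    HasCount-reindex xs xs-distinct sat sat-injective (λ j → xs-U (sat j) , sat-holds j) cover-sat ,
    HasCount-reindex xs xs-distinct unsat unsat-injective (λ j → xs-U (unsat j) , unsat-fails j) cover-unsat ,
    size
    where
    open FinPartition (finPartition {Q = λ i → P (lookup xs i)} (λ i → P? (lookup xs i)))
    at : ∀ {k} {σ : Fin k → Fin _} {i j} → σ j ≡ i → ∀ {x} → x ≈ lookup xs i → x ≈ lookup xs (σ j)
    at ≡.refl x≈ = x≈
    cover-sat : ∀ x → U x × P x → ∃ λ j → x ≈ lookup xs (sat j)
    cover-sat x (ux , px) with xs-cover x ux
    ... | i , x≈ with covers i
    ... | inj₁ (j , e) = j , at {σ = sat} e x≈
    ... | inj₂ (j , e) = ⊥-elim (unsat-fails j (P-resp (at {σ = unsat} e x≈) px))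
    cover-unsat : ∀ x → U x × ¬ P x → ∃ λ j → x ≈ lookup xs (unsat j)
    cover-unsat x (ux , ¬px) with xs-cover x ux
    ... | i , x≈ with covers i
    ... | inj₂ (j , e) = j , at {σ = unsat} e x≈
    ... | inj₁ (j , e) = ⊥-elim (¬px (P-resp (≈.sym (at {σ = sat} e x≈)) (sat-holds j)))

  -- A missed y together with the image of the a elements would give a + 1 distinct elements.
  injective⇒surjective : ∀ {B : Set} {_≈B_ : Rel B 0ℓ} {U : B → Set} {a}
                       → HasCount _≈B_ U a → HasCount _≈_ (λ _ → ⊤) a
                       → (∀ x y → Dec (x ≈ y)) → (f : B → A)
                       → (∀ x y → U x → U y → f x ≈ f y → x ≈B y)
                       → ∀ y → Σ B λ x → U x × f x ≈ y
  injective⇒surjective {a = a} (xs , xs-U , xs-distinct , _) card _≟_ f f-injective y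
    with FinP.any? (λ i → f (lookup xs i) ≟ y)
  ... | yes (i , e) = lookup xs i , xs-U i , e
  ... | no y∉image = ⊥-elim (ℕP.<-irrefl ≡.refl
          (distinct⇒≤count {_≈B_ = _≈_} (y ∷ Vec.map f xs) (λ _ → tt) distinct card (λ x → x) (λ _ _ → tt) (λ _ _ _ _ e → e)))
    where
    lookup-map : ∀ i → lookup (Vec.map f xs) i ≡ f (lookup xs i)
    lookup-map i = VecP.lookup-map i f xs
    distinct : Distinct _≈_ (y ∷ Vec.map f xs)
    distinct zero    zero    _ = ≡.refl
    distinct zero    (suc j) e = ⊥-elim (y∉image (j , ≈.sym (≡.subst (y ≈_) (lookup-map j) e)))
    distinct (suc i) zero    e = ⊥-elim (y∉image (i , ≡.subst (_≈ y) (lookup-map i) e))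
    distinct (suc i) (suc j) e = ≡.cong suc (xs-distinct i j
      (f-injective _ _ (xs-U i) (xs-U j) (≡.subst₂ _≈_ (lookup-map i) (lookup-map j) e)))

module FieldProperties (F : Field) where
  open Field F hiding (zero)
  open import Algebra.Properties.AbelianGroup +-abelianGroup public
    using (x∙y⁻¹≈ε⇒x≈y; x≈y⇒x∙y⁻¹≈ε)
  open import Relation.Binary.Reasoning.Setoid setoid

  NonZero : Carrier → Set
  NonZero x = ¬ (x ≈ 0#)

  inv : (x : Carrier) → NonZero x → Carrier
  inv x x≉0 = proj₁ (inverse x x≉0)

  *-inverseʳ : ∀ x (x≉0 : NonZero x) → x * inv x x≉0 ≈ 1#
  *-inverseʳ x x≉0 = proj₂ (inverse x x≉0)

  *-inverseˡ : ∀ x (x≉0 : NonZero x) → inv x x≉0 * x ≈ 1#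
  *-inverseˡ x x≉0 = trans (*-comm _ _) (*-inverseʳ x x≉0)

  *-cancelˡ : ∀ {x y z} → NonZero x → x * y ≈ x * z → y ≈ z
  *-cancelˡ {x} {y} {z} x≉0 e = begin
    y                 ≈⟨ *-identityˡ y ⟨
    1# * y            ≈⟨ *-congʳ (*-inverseˡ x x≉0) ⟨
    (x⁻¹ * x) * y     ≈⟨ *-assoc x⁻¹ x y ⟩
    x⁻¹ * (x * y)     ≈⟨ *-congˡ e ⟩
    x⁻¹ * (x * z)     ≈⟨ *-assoc x⁻¹ x z ⟨
    (x⁻¹ * x) * z     ≈⟨ *-congʳ (*-inverseˡ x x≉0) ⟩
    1# * z            ≈⟨ *-identityˡ z ⟩
    z                 ∎
    where x⁻¹ = inv x x≉0

  *-cancelʳ : ∀ {x y z} → NonZero x → y * x ≈ z * x → y ≈ z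
  *-cancelʳ x≉0 e = *-cancelˡ x≉0 (trans (*-comm _ _) (trans e (*-comm _ _)))

  x*y≈0⇒y≈0 : ∀ {x y} → NonZero x → x * y ≈ 0# → y ≈ 0#
  x*y≈0⇒y≈0 x≉0 e = *-cancelˡ x≉0 (trans e (sym (zeroʳ _)))

  *-nonZero : ∀ {x y} → NonZero x → NonZero y → NonZero (x * y)
  *-nonZero x≉0 y≉0 e = y≉0 (x*y≈0⇒y≈0 x≉0 e)

  inv-nonZero : ∀ x (x≉0 : NonZero x) → NonZero (inv x x≉0)
  inv-nonZero x x≉0 e = 1≉0 (trans (sym (*-inverseʳ x x≉0)) (trans (*-congˡ e) (zeroʳ _)))

  module FiniteField {k} (card : HasCard F k) where
    private
      elements = proj₁ card
      distinct = proj₁ (proj₂ (proj₂ card))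
      cover    = proj₂ (proj₂ (proj₂ card))

    index : Carrier → Fin k
    index x = proj₁ (cover x tt)

    index-correct : ∀ x → x ≈ lookup elements (index x)
    index-correct x = proj₂ (cover x tt)

    index-cong : ∀ {x y} → index x ≡ index y → x ≈ y
    index-cong {x} {y} e = trans (index-correct x)
      (trans (reflexive (≡.cong (lookup elements) e)) (sym (index-correct y)))

    _≟_ : ∀ x y → Dec (x ≈ y)
    x ≟ y with index x FinP.≟ index y
    ... | yes e = yes (index-cong e)
    ... | no ne = no (λ e → ne (distinct _ _ (trans (sym (index-correct x)) (trans e (index-correct y)))))

module Polynomials (K : Field) (_≟_ : ∀ x y → Dec (Field._≈_ K x y)) where
  open Field K hiding (zero)
  open FieldProperties K
  open Poly K public
  open import Algebra.Properties.Ring ring using (-0#≈0#)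

  IsZero : Pol → Set
  IsZero p = ∀ k → coeff p k ≈ 0#

  -- A record rather than a function, so that p and m can be inferred from DegreeBelow p m.
  record DegreeBelow (p : Pol) (m : ℕ) : Set where
    constructor degreeBelow
    field vanishes : ∀ k → m ≤ k → coeff p k ≈ 0#
  open DegreeBelow public

  HasDegree : Pol → ℕ → Set
  HasDegree p d = NonZero (coeff p d) × DegreeBelow p (suc d)

  negP : Pol → Pol
  negP = List.map (λ x → - x)

  scaleP : Carrier → Pol → Pol
  scaleP a = List.map (a *_)

  _-P_ : Pol → Pol → Pol
  p -P r = p +P negP r

  ≈P-sym : ∀ {p r} → p ≈P r → r ≈P p
  ≈P-sym e k = sym (e k)

  coeff-+P : ∀ p r k → coeff (p +P r) k ≈ coeff p k + coeff r k
  coeff-+P []      r       k       = sym (+-identityˡ _)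
  coeff-+P (a ∷ p) []      k       = sym (+-identityʳ _)
  coeff-+P (a ∷ p) (b ∷ r) zero    = refl
  coeff-+P (a ∷ p) (b ∷ r) (suc k) = coeff-+P p r k

  coeff-map : ∀ (f : Carrier → Carrier) → f 0# ≈ 0# → ∀ p k → coeff (List.map f p) k ≈ f (coeff p k)
  coeff-map f f0≈0 []      k       = sym f0≈0
  coeff-map f f0≈0 (a ∷ p) zero    = refl
  coeff-map f f0≈0 (a ∷ p) (suc k) = coeff-map f f0≈0 p k

  coeff-scaleP : ∀ a p k → coeff (scaleP a p) k ≈ a * coeff p k
  coeff-scaleP a = coeff-map (a *_) (zeroʳ a)

  coeff-negP : ∀ p k → coeff (negP p) k ≈ - coeff p k
  coeff-negP = coeff-map (λ x → - x) -0#≈0#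

  coeff-−P : ∀ p r k → coeff (p -P r) k ≈ coeff p k - coeff r k
  coeff-−P p r k = trans (coeff-+P p (negP r) k) (+-congˡ (coeff-negP r k))

  coeff-*P-∷ : ∀ a p r k → coeff ((a ∷ p) *P r) k ≈ a * coeff r k + coeff (0# ∷ (p *P r)) k
  coeff-*P-∷ a p r k = trans (coeff-+P (scaleP a r) (0# ∷ (p *P r)) k) (+-congʳ (coeff-scaleP a r k))

  IsZero-*Pˡ : ∀ p r → IsZero p → IsZero (p *P r)
  IsZero-*Pˡ []      r z k = refl
  IsZero-*Pˡ (a ∷ p) r z k = trans (coeff-*P-∷ a p r k)
    (trans (+-cong (trans (*-congʳ (z 0)) (zeroˡ _)) (shifted k)) (+-identityʳ _))
    where
    shifted : ∀ k → coeff (0# ∷ (p *P r)) k ≈ 0#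
    shifted zero    = refl
    shifted (suc k) = IsZero-*Pˡ p r (λ j → z (suc j)) k

  IsZero-*Pʳ : ∀ p r → IsZero r → IsZero (p *P r)
  IsZero-*Pʳ []      r z k = refl
  IsZero-*Pʳ (a ∷ p) r z k = trans (coeff-*P-∷ a p r k)
    (trans (+-cong (trans (*-congˡ (z k)) (zeroʳ _)) (shifted k)) (+-identityʳ _))
    where
    shifted : ∀ k → coeff (0# ∷ (p *P r)) k ≈ 0#
    shifted zero    = refl
    shifted (suc k) = IsZero-*Pʳ p r z k

  DegreeBelow-mono : ∀ {p m m′} → m ≤ m′ → DegreeBelow p m → DegreeBelow p m′
  DegreeBelow-mono m≤m′ b = degreeBelow λ k m′≤k → vanishes b k (ℕP.≤-trans m≤m′ m′≤k)

  DegreeBelow-0⇒IsZero : ∀ {p} → DegreeBelow p 0 → IsZero p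
  DegreeBelow-0⇒IsZero b k = vanishes b k z≤n

  IsZero⇒DegreeBelow : ∀ {p m} → IsZero p → DegreeBelow p m
  IsZero⇒DegreeBelow z = degreeBelow λ k _ → z k

  DegreeBelow-pred : ∀ {p d} → DegreeBelow p (suc d) → coeff p d ≈ 0# → DegreeBelow p d
  DegreeBelow-pred {p} {d} b c≈0 = degreeBelow vanishes′
    where
    vanishes′ : ∀ k → d ≤ k → coeff p k ≈ 0#
    vanishes′ k d≤k with d ℕP.≟ k
    ... | yes ≡.refl = c≈0
    ... | no d≢k     = vanishes b k (ℕP.≤∧≢⇒< d≤k d≢k)

  DegreeBelow-+P : ∀ {p r m} → DegreeBelow p m → DegreeBelow r m → DegreeBelow (p +P r) m
  DegreeBelow-+P {p} {r} bp br = degreeBelow λ k m≤k →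
    trans (coeff-+P p r k) (trans (+-cong (vanishes bp k m≤k) (vanishes br k m≤k)) (+-identityʳ _))

  DegreeBelow-scaleP : ∀ {p m} a → DegreeBelow p m → DegreeBelow (scaleP a p) m
  DegreeBelow-scaleP {p} a b = degreeBelow λ k m≤k →
    trans (coeff-scaleP a p k) (trans (*-congˡ (vanishes b k m≤k)) (zeroʳ _))

  DegreeBelow-negP : ∀ {p m} → DegreeBelow p m → DegreeBelow (negP p) m
  DegreeBelow-negP {p} b = degreeBelow λ k m≤k →
    trans (coeff-negP p k) (trans (-‿cong (vanishes b k m≤k)) -0#≈0#)

  DegreeBelow-−P : ∀ {p r m} → DegreeBelow p m → DegreeBelow r m → DegreeBelow (p -P r) m
  DegreeBelow-−P bp br = DegreeBelow-+P bp (DegreeBelow-negP br)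

  DegreeBelow-cong : ∀ {p r m} → p ≈P r → DegreeBelow p m → DegreeBelow r m
  DegreeBelow-cong e b = degreeBelow λ k m≤k → trans (sym (e k)) (vanishes b k m≤k)

  DegreeBelow-∷ : ∀ {a p m} → DegreeBelow p m → DegreeBelow (a ∷ p) (suc m)
  DegreeBelow-∷ b = degreeBelow λ { zero () ; (suc k) (s≤s m≤k) → vanishes b k m≤k }

  DegreeBelow-tail : ∀ {a p m} → DegreeBelow (a ∷ p) (suc m) → DegreeBelow p m
  DegreeBelow-tail b = degreeBelow λ k m≤k → vanishes b (suc k) (s≤s m≤k)

  DegreeBelow-1⇒constant : ∀ {p} → DegreeBelow p 1 → p ≈P (coeff p 0 ∷ [])
  DegreeBelow-1⇒constant b zero    = refl
  DegreeBelow-1⇒constant b (suc k) = vanishes b (suc k) (s≤s z≤n)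

  coeff-constant-*P : ∀ p r k → DegreeBelow p 1 → coeff (p *P r) k ≈ coeff p 0 * coeff r k
  coeff-constant-*P []      r k b = sym (zeroˡ _)
  coeff-constant-*P (a ∷ p) r k b = trans (coeff-*P-∷ a p r k) (trans (+-congˡ (shifted k)) (+-identityʳ _))
    where
    shifted : ∀ k → coeff (0# ∷ (p *P r)) k ≈ 0#
    shifted zero    = refl
    shifted (suc k) = IsZero-*Pˡ p r (DegreeBelow-0⇒IsZero (DegreeBelow-tail b)) k

  leading-*P : ∀ p r i j → DegreeBelow p (suc i) → DegreeBelow r (suc j)
             → DegreeBelow (p *P r) (suc (i ℕ.+ j)) × coeff (p *P r) (i ℕ.+ j) ≈ coeff p i * coeff r j
  leading-*P p r zero j bp br =
    degreeBelow (λ k j<k → trans (coeff-constant-*P p r k bp) (trans (*-congˡ (vanishes br k j<k)) (zeroʳ _))) ,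
    coeff-constant-*P p r j bp
  leading-*P []      r (suc i) j bp br = IsZero⇒DegreeBelow (λ _ → refl) , sym (zeroˡ _)
  leading-*P (a ∷ p) r (suc i) j bp br = degreeBelow vanishes′ , top
    where
    ih = leading-*P p r i j (DegreeBelow-tail bp) br
    r-vanishes : ∀ k → j ≤ k → a * coeff r (suc k) ≈ 0#
    r-vanishes k j≤k = trans (*-congˡ (vanishes br (suc k) (s≤s j≤k))) (zeroʳ _)
    vanishes′ : ∀ k → suc (suc (i ℕ.+ j)) ≤ k → coeff ((a ∷ p) *P r) k ≈ 0#
    vanishes′ (suc k) (s≤s i+j<k) = trans (coeff-*P-∷ a p r (suc k))
      (trans (+-cong (r-vanishes k (ℕP.≤-trans (ℕP.m≤n+m j i) (ℕP.<⇒≤ i+j<k))) (vanishes (proj₁ ih) k i+j<k)) (+-identityʳ _))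
    top : coeff ((a ∷ p) *P r) (suc (i ℕ.+ j)) ≈ coeff p i * coeff r j
    top = trans (coeff-*P-∷ a p r (suc (i ℕ.+ j)))
      (trans (+-cong (r-vanishes (i ℕ.+ j) (ℕP.m≤n+m j i)) (proj₂ ih)) (+-identityˡ _))

  DegreeBelow-*P : ∀ {p r i j} → DegreeBelow p i → DegreeBelow r j → DegreeBelow (p *P r) (i ℕ.+ j)
  DegreeBelow-*P {p} {r} {zero}  bp br = IsZero⇒DegreeBelow (IsZero-*Pˡ p r (DegreeBelow-0⇒IsZero bp))
  DegreeBelow-*P {p} {r} {suc i} {zero} bp br =
    IsZero⇒DegreeBelow (IsZero-*Pʳ p r (DegreeBelow-0⇒IsZero br))
  DegreeBelow-*P {p} {r} {suc i} {suc j} bp br =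
    DegreeBelow-mono (ℕP.≤-reflexive (≡.sym (ℕP.+-suc (suc i) j)))
      (DegreeBelow-mono (ℕP.n≤1+n _) (proj₁ (leading-*P p r i j bp br)))

  HasDegree-*P : ∀ {p r i j} → HasDegree p i → HasDegree r j → HasDegree (p *P r) (i ℕ.+ j)
  HasDegree-*P {p} {r} {i} {j} (p≉0 , bp) (r≉0 , br) =
    let (b , top) = leading-*P p r i j bp br in (λ z → *-nonZero p≉0 r≉0 (trans (sym top) z)) , b

  HasDegree⇒¬IsZero : ∀ {p d} → HasDegree p d → ¬ IsZero p
  HasDegree⇒¬IsZero (c≉0 , _) z = c≉0 (z _)

  degree<bound : ∀ {p d m} → HasDegree p d → DegreeBelow p m → d < m
  degree<bound {p} {d} {m} (c≉0 , _) b with m ℕP.≤? d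
  ... | yes m≤d = ⊥-elim (c≉0 (vanishes b d m≤d))
  ... | no m≰d  = ℕP.≰⇒> m≰d

  degree-unique : ∀ {p d d′} → HasDegree p d → HasDegree p d′ → d ≡ d′
  degree-unique dp dp′ = ℕP.≤-antisym (ℕP.≤-pred (degree<bound dp (proj₂ dp′)))
                                      (ℕP.≤-pred (degree<bound dp′ (proj₂ dp)))

  HasDegree-cong : ∀ {p r d} → p ≈P r → HasDegree p d → HasDegree r d
  HasDegree-cong e (c≉0 , b) = (λ z → c≉0 (trans (e _) z)) , DegreeBelow-cong e b

  HasDegree-oneP : HasDegree oneP 0
  HasDegree-oneP = 1≉0 , degreeBelow λ { zero () ; (suc k) _ → refl }

  Monic⇒HasDegree : ∀ {p} → (m : Monic p) → HasDegree p (proj₁ m)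
  Monic⇒HasDegree (d , top≈1 , above) = (λ z → 1≉0 (trans (sym top≈1) z)) , degreeBelow above

  isZero⊎degree : ∀ p → IsZero p ⊎ ∃ (HasDegree p)
  isZero⊎degree [] = inj₁ (λ k → refl)
  isZero⊎degree (a ∷ p) with isZero⊎degree p
  ... | inj₂ (d , c≉0 , b) = inj₂ (suc d , c≉0 , DegreeBelow-∷ b)
  ... | inj₁ z with a ≟ 0#
  ...   | yes a≈0 = inj₁ (λ { zero → a≈0 ; (suc k) → z k })
  ...   | no a≉0  = inj₂ (0 , a≉0 , degreeBelow λ { zero () ; (suc k) _ → z k })

  degree : ∀ p → ¬ IsZero p → ∃ (HasDegree p)
  degree p p≉0 with isZero⊎degree p
  ... | inj₁ z = ⊥-elim (p≉0 z)
  ... | inj₂ d = d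

  degreeBelow? : ∀ p m → Dec (DegreeBelow p m)
  degreeBelow? []      m = yes (IsZero⇒DegreeBelow λ _ → refl)
  degreeBelow? (a ∷ p) zero with a ≟ 0# | degreeBelow? p 0
  ... | yes a≈0 | yes b = yes (degreeBelow λ { zero _ → a≈0 ; (suc k) _ → vanishes b k z≤n })
  ... | no a≉0  | _     = no (λ b → a≉0 (vanishes b 0 z≤n))
  ... | yes _   | no ¬b = no (λ b → ¬b (degreeBelow λ k _ → vanishes b (suc k) z≤n))
  degreeBelow? (a ∷ p) (suc m) with degreeBelow? p m
  ... | yes b = yes (DegreeBelow-∷ b)
  ... | no ¬b = no (λ b → ¬b (DegreeBelow-tail b))

  isZero? : ∀ p → Dec (IsZero p)
  isZero? p with degreeBelow? p 0
  ... | yes b = yes (DegreeBelow-0⇒IsZero b)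
  ... | no ¬b = no (λ z → ¬b (IsZero⇒DegreeBelow z))

  HasDegree-scaleP : ∀ {p d c} → NonZero c → HasDegree p d → HasDegree (scaleP c p) d
  HasDegree-scaleP {p} {d} {c} c≉0 (top≉0 , below) =
    (λ z → *-nonZero c≉0 top≉0 (trans (sym (coeff-scaleP c p d)) z)) , DegreeBelow-scaleP c below

  ∣oneP⇒HasDegree-0 : ∀ {p} → p ∣P oneP → HasDegree p 0
  ∣oneP⇒HasDegree-0 {p} (w , pw≈1) = ≡.subst (HasDegree p) (ℕP.m+n≡0⇒m≡0 _ degrees) (proj₂ p-degree)
    where
    p-degree = degree p (λ z → 1≉0 (trans (sym (pw≈1 0)) (IsZero-*Pˡ p w z 0)))
    w-degree = degree w (λ z → 1≉0 (trans (sym (pw≈1 0)) (IsZero-*Pʳ p w z 0)))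
    degrees : proj₁ p-degree ℕ.+ proj₁ w-degree ≡ 0
    degrees = degree-unique (HasDegree-cong {p *P w} {oneP} pw≈1 (HasDegree-*P (proj₂ p-degree) (proj₂ w-degree)))
                            HasDegree-oneP

  HasDegree-0⇒∣oneP : ∀ {p} → HasDegree p 0 → p ∣P oneP
  HasDegree-0⇒∣oneP {p} (c≉0 , below) = (inv c c≉0 ∷ []) , λ k → trans (coeff-constant-*P p _ k below) (unit k)
    where
    c = coeff p 0
    unit : ∀ k → c * coeff (inv c c≉0 ∷ []) k ≈ coeff oneP k
    unit zero    = *-inverseʳ c c≉0
    unit (suc k) = zeroʳ c

  cofactor-below : ∀ {d h f k m} → HasDegree d (suc k) → (d *P h) ≈P f → DegreeBelow f (suc m) → DegreeBelow h m
  cofactor-below {d} {h} {f} {k} d-degree d*h≈f f-below with isZero⊎degree h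
  ... | inj₁ h≈0 = IsZero⇒DegreeBelow h≈0
  ... | inj₂ (j , h-degree) = DegreeBelow-mono (ℕP.≤-pred (ℕP.≤-trans (s≤s (s≤s (ℕP.m≤n+m j k))) j+k<m)) (proj₂ h-degree)
    where
    j+k<m = degree<bound (HasDegree-cong {d *P h} {f} d*h≈f (HasDegree-*P d-degree h-degree)) f-below

  toVec : ∀ m → Pol → Vec Carrier m
  toVec zero    p       = []
  toVec (suc m) []      = 0# ∷ toVec m []
  toVec (suc m) (a ∷ p) = a ∷ toVec m p

  toPol-toVec : ∀ m p → DegreeBelow p m → toPol (toVec m p) ≈P p
  toPol-toVec zero    p       b k       = sym (vanishes b k z≤n)
  toPol-toVec (suc m) []      b zero    = refl
  toPol-toVec (suc m) []      b (suc k) = toPol-toVec m [] (IsZero⇒DegreeBelow λ _ → refl) k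
  toPol-toVec (suc m) (a ∷ p) b zero    = refl
  toPol-toVec (suc m) (a ∷ p) b (suc k) = toPol-toVec m p (DegreeBelow-tail b) k

  DegreeBelow-toPol : ∀ {m} (v : Vec Carrier m) → DegreeBelow (toPol v) m
  DegreeBelow-toPol []      = IsZero⇒DegreeBelow (λ _ → refl)
  DegreeBelow-toPol (x ∷ v) = DegreeBelow-∷ (DegreeBelow-toPol v)

  coeff-toPol : ∀ {m} (v : Vec Carrier m) i → coeff (toPol v) (toℕ i) ≡ lookup v i
  coeff-toPol (x ∷ v) zero    = ≡.refl
  coeff-toPol (x ∷ v) (suc i) = coeff-toPol v i

  IsZero-toPol : ∀ {m} (v : Vec Carrier m) → (∀ i → lookup v i ≈ 0#) → IsZero (toPol v)
  IsZero-toPol []      z k       = refl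
  IsZero-toPol (x ∷ v) z zero    = z zero
  IsZero-toPol (x ∷ v) z (suc k) = IsZero-toPol v (λ i → z (suc i)) k

  toPol-map : ∀ {m} (f : Carrier → Carrier) (v : Vec Carrier m) → toPol (Vec.map f v) ≡ List.map f (toPol v)
  toPol-map f []      = ≡.refl
  toPol-map f (x ∷ v) = ≡.cong (f x ∷_) (toPol-map f v)

  monomial : ℕ → Carrier → Pol
  monomial zero    c = c ∷ []
  monomial (suc k) c = 0# ∷ monomial k c

  coeff-monomial : ∀ k c → coeff (monomial k c) k ≡ c
  coeff-monomial zero    c = ≡.refl
  coeff-monomial (suc k) c = coeff-monomial k c

  DegreeBelow-monomial : ∀ k c → DegreeBelow (monomial k c) (suc k)
  DegreeBelow-monomial zero    c = DegreeBelow-∷ (IsZero⇒DegreeBelow λ _ → refl)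
  DegreeBelow-monomial (suc k) c = DegreeBelow-∷ (DegreeBelow-monomial k c)

  cancel-leading : ∀ {p r M e} (r-degree : HasDegree r e) → e ≤ M → DegreeBelow p (suc M)
                 → DegreeBelow (p -P (monomial (M ∸ e) (coeff p M * inv (coeff r e) (proj₁ r-degree)) *P r)) M
  cancel-leading {p} {r} {M} {e} (lead≉0 , r-below) e≤M p-below =
    DegreeBelow-pred (DegreeBelow-−P p-below (≡.subst (λ k → DegreeBelow (t *P r) (suc k)) M∸e+e≡M (proj₁ leading)))
      (trans (coeff-−P p (t *P r) M) (x≈y⇒x∙y⁻¹≈ε (sym t*r-top)))
    where
    c = coeff p M * inv (coeff r e) lead≉0
    t = monomial (M ∸ e) c
    M∸e+e≡M = ℕP.m∸n+n≡m e≤M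
    leading = leading-*P t r (M ∸ e) e (DegreeBelow-monomial (M ∸ e) c) r-below
    t*r-top : coeff (t *P r) M ≈ coeff p M
    t*r-top = ≡.subst (λ k → coeff (t *P r) k ≈ coeff p M) M∸e+e≡M
      (trans (proj₂ leading) (trans (*-congʳ (reflexive (coeff-monomial (M ∸ e) c)))
        (trans (*-assoc _ _ _) (trans (*-congˡ (*-inverseˡ _ lead≉0)) (*-identityʳ _)))))

module Evaluation (K L : Field) (_≟K_ : ∀ x y → Dec (Field._≈_ K x y))
  (ι : Field.Carrier K → Field.Carrier L)
  (ι-hom : RingMorphisms.IsRingHomomorphism (Field.rawRing K) (Field.rawRing L) ι)
  (α : Field.Carrier L) where

  private
    module K = Field K
    module KP = FieldProperties K
  open Field L hiding (zero)
  open FieldProperties L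
  open Polynomials K _≟K_ public
  open IntegerCoefficientSolver commRing using (solve; _:+_; _:*_; _:-_; :-_; _:=_)
  open import Relation.Binary.Reasoning.Setoid setoid
  module ι = RingMorphisms.IsRingHomomorphism ι-hom

  ι≈0⇒≈0 : ∀ {c} → ι c ≈ 0# → c K.≈ K.0#
  ι≈0⇒≈0 {c} ιc≈0 with c ≟K K.0#
  ... | yes c≈0 = c≈0
  ... | no c≉0  = ⊥-elim (1≉0 (begin
      1#                        ≈⟨ ι.1#-homo ⟨
      ι K.1#                    ≈⟨ ι.⟦⟧-cong (KP.*-inverseʳ c c≉0) ⟨
      ι (c K.* KP.inv c c≉0)    ≈⟨ ι.*-homo c _ ⟩
      ι c * ι (KP.inv c c≉0)    ≈⟨ *-congʳ ιc≈0 ⟩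
      0# * ι (KP.inv c c≉0)     ≈⟨ zeroˡ _ ⟩
      0#                        ∎))

  ι-nonZero : ∀ {c} → KP.NonZero c → NonZero (ι c)
  ι-nonZero c≉0 e = c≉0 (ι≈0⇒≈0 e)

  eval : Pol → Carrier
  eval []      = 0#
  eval (a ∷ p) = ι a + α * eval p

  eval-IsZero : ∀ p → IsZero p → eval p ≈ 0#
  eval-IsZero []      z = refl
  eval-IsZero (a ∷ p) z = begin
    ι a + α * eval p  ≈⟨ +-cong (trans (ι.⟦⟧-cong (z 0)) ι.0#-homo) (*-congˡ (eval-IsZero p (λ k → z (suc k)))) ⟩
    0# + α * 0#       ≈⟨ trans (+-identityˡ _) (zeroʳ _) ⟩
    0#                ∎

  eval-cong : ∀ p r → p ≈P r → eval p ≈ eval r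
  eval-cong []      r       e = sym (eval-IsZero r (λ k → K.sym (e k)))
  eval-cong (a ∷ p) []      e = eval-IsZero (a ∷ p) e
  eval-cong (a ∷ p) (b ∷ r) e = +-cong (ι.⟦⟧-cong (e 0)) (*-congˡ (eval-cong p r (λ k → e (suc k))))

  eval-constant : ∀ c → eval (c ∷ []) ≈ ι c
  eval-constant c = trans (+-congˡ (zeroʳ _)) (+-identityʳ _)

  eval-oneP : eval oneP ≈ 1#
  eval-oneP = trans (eval-constant K.1#) ι.1#-homo

  eval-+P : ∀ p r → eval (p +P r) ≈ eval p + eval r
  eval-+P []      r       = sym (+-identityˡ _)
  eval-+P (a ∷ p) []      = sym (+-identityʳ _)
  eval-+P (a ∷ p) (b ∷ r) = begin
    ι (a K.+ b) + α * eval (p +P r)        ≈⟨ +-cong (ι.+-homo a b) (*-congˡ (eval-+P p r)) ⟩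
    (ι a + ι b) + α * (eval p + eval r)    ≈⟨ solve 5 (λ x y z u v → (x :+ y) :+ z :* (u :+ v) := (x :+ z :* u) :+ (y :+ z :* v))
                                                refl (ι a) (ι b) α (eval p) (eval r) ⟩
    (ι a + α * eval p) + (ι b + α * eval r) ∎

  eval-scaleP : ∀ c p → eval (scaleP c p) ≈ ι c * eval p
  eval-scaleP c []      = sym (zeroʳ _)
  eval-scaleP c (a ∷ p) = begin
    ι (c K.* a) + α * eval (scaleP c p)  ≈⟨ +-cong (ι.*-homo c a) (*-congˡ (eval-scaleP c p)) ⟩
    ι c * ι a + α * (ι c * eval p)       ≈⟨ solve 4 (λ x y z u → x :* y :+ z :* (x :* u) := x :* (y :+ z :* u))
                                              refl (ι c) (ι a) α (eval p) ⟩
    ι c * (ι a + α * eval p)             ∎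

  eval-negP : ∀ p → eval (negP p) ≈ - eval p
  eval-negP []      = sym -0#≈0#
    where open import Algebra.Properties.Ring ring using (-0#≈0#)
  eval-negP (a ∷ p) = begin
    ι (K.- a) + α * eval (negP p)   ≈⟨ +-cong (ι.-‿homo a) (*-congˡ (eval-negP p)) ⟩
    - ι a + α * (- eval p)          ≈⟨ solve 3 (λ x y z → :- x :+ y :* (:- z) := :- (x :+ y :* z)) refl (ι a) α (eval p) ⟩
    - (ι a + α * eval p)            ∎

  eval-−P : ∀ p r → eval (p -P r) ≈ eval p - eval r
  eval-−P p r = trans (eval-+P p (negP r)) (+-congˡ (eval-negP r))

  eval-*P : ∀ p r → eval (p *P r) ≈ eval p * eval r
  eval-*P []      r = sym (zeroˡ _)
  eval-*P (a ∷ p) r = begin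
    eval (scaleP a r +P (K.0# ∷ (p *P r)))           ≈⟨ eval-+P (scaleP a r) _ ⟩
    eval (scaleP a r) + (ι K.0# + α * eval (p *P r)) ≈⟨ +-cong (eval-scaleP a r) (trans (+-cong ι.0#-homo (*-congˡ (eval-*P p r))) (+-identityˡ _)) ⟩
    ι a * eval r + α * (eval p * eval r)             ≈⟨ solve 4 (λ x y z u → x :* y :+ z :* (u :* y) := (x :+ z :* u) :* y)
                                                          refl (ι a) (eval r) α (eval p) ⟩
    (ι a + α * eval p) * eval r                      ∎

module FiniteExtension (q n′ : ℕ) (K L : Field)
  (K-card : HasCard K q) (L-card : HasCard L (q ^ (2 ℕ.* suc n′)))
  (ι : Field.Carrier K → Field.Carrier L)
  (ι-hom : RingMorphisms.IsRingHomomorphism (Field.rawRing K) (Field.rawRing L) ι)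
  (α : Field.Carrier L) (α-generates : Extension.Generates K L ι α) where

  n : ℕ
  n = suc n′

  Q : ℕ
  Q = q ^ (2 ℕ.* n)

  module K where
    open Field K public hiding (zero)
    open FieldProperties K public
    open FiniteField K-card public
  open Field L hiding (zero)
  open FieldProperties L
  open FiniteField L-card
  open Evaluation K L K._≟_ ι ι-hom α public
  open Extension K L ι using (IsSubfieldOverK; pow)
  open IntegerCoefficientSolver commRing using (solve; _:+_; _:*_; _:-_; :-_; _:=_; con)
  open import Relation.Binary.Reasoning.Setoid setoid

  2≤q : 2 ≤ q
  2≤q = Counting.distinct⇒≤count K._≈_ K.isEquivalence {P = λ _ → ⊤} (K.0# ∷ K.1# ∷ [])
    (λ _ → tt) distinct K-card (λ x → x) (λ _ _ → tt) (λ _ _ _ _ e → e)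
    where
    distinct : Distinct K._≈_ (K.0# ∷ K.1# ∷ [])
    distinct zero       zero       _ = ≡.refl
    distinct zero       (suc zero) e = ⊥-elim (K.1≉0 (K.sym e))
    distinct (suc zero) zero       e = ⊥-elim (K.1≉0 e)
    distinct (suc zero) (suc zero) _ = ≡.refl

  _≈V_ : ∀ {m} → Rel (Vec K.Carrier m) 0ℓ
  u ≈V v = toPol u ≈P toPol v

  ≈V-isEquivalence : ∀ {m} → IsEquivalence (_≈V_ {m})
  ≈V-isEquivalence = record
    { refl = λ _ → K.refl ; sym = λ e k → K.sym (e k) ; trans = λ e f k → K.trans (e k) (f k) }

  vectorCount : ∀ m → HasCount (_≈V_ {m}) (λ _ → ⊤) (q ^ m)
  vectorCount zero    = [] ∷ [] , (λ _ → tt) , (λ { zero zero _ → ≡.refl }) , λ { [] _ → zero , λ _ → K.refl }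
  vectorCount (suc m) = Counting.HasCount-map _≈V_ ≈V-isEquivalence {_≈B_ = Pointwise K._≈_ _≈V_}
    (HasCount-× {_≈A_ = K._≈_} {_≈B_ = _≈V_} K-card (vectorCount m)) (λ (x , v) → x ∷ v)
    (λ (e , f) → λ { zero → e ; (suc k) → f k }) (λ _ _ → tt)
    (λ _ _ _ _ e → e 0 , λ k → e (suc k))
    λ { (x ∷ v) _ → (x , v) , (tt , tt) , λ _ → K.refl }

  IsPolynomialValue : Carrier → Set
  IsPolynomialValue x = Σ Pol λ p → eval p ≈ x

  IsPolynomialValue-* : ∀ {x y} → IsPolynomialValue x → IsPolynomialValue y → IsPolynomialValue (x * y)
  IsPolynomialValue-* (p , px) (r , ry) = p *P r , trans (eval-*P p r) (*-cong px ry)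

  IsPolynomialValue-pow : ∀ {x} → IsPolynomialValue x → ∀ k → IsPolynomialValue (pow x k)
  IsPolynomialValue-pow px zero    = oneP , eval-oneP
  IsPolynomialValue-pow px (suc k) = IsPolynomialValue-* px (IsPolynomialValue-pow px k)

  pow-+ : ∀ x a b → pow x (a ℕ.+ b) ≈ pow x a * pow x b
  pow-+ x zero    b = sym (*-identityˡ _)
  pow-+ x (suc a) b = trans (*-congˡ (pow-+ x a b)) (sym (*-assoc _ _ _))

  pow-nonZero : ∀ {x} → NonZero x → ∀ k → NonZero (pow x k)
  pow-nonZero x≉0 zero    = 1≉0
  pow-nonZero x≉0 (suc k) = *-nonZero x≉0 (pow-nonZero x≉0 k)

  -- Among the Q + 1 powers x⁰, …, x^Q two coincide, so some power of x is 1.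
  inverse-is-pow : ∀ {x} → NonZero x → ∃ λ t → x * pow x t ≈ 1#
  inverse-is-pow {x} x≉0 with FinP.pigeonhole (ℕP.n<1+n Q) (λ (i : Fin (suc Q)) → index (pow x (toℕ i)))
  ... | i , j , i<j , same = t , sym (*-cancelˡ (pow-nonZero x≉0 (toℕ i)) (begin
    pow x (toℕ i) * 1#                 ≈⟨ *-identityʳ _ ⟩
    pow x (toℕ i)                      ≈⟨ index-cong same ⟩
    pow x (toℕ j)                      ≡⟨ ≡.cong (pow x) j≡i+1+t ⟩
    pow x (toℕ i ℕ.+ suc t)            ≈⟨ pow-+ x (toℕ i) (suc t) ⟩
    pow x (toℕ i) * (x * pow x t)      ∎))
    where
    t = toℕ j ∸ suc (toℕ i)
    j≡i+1+t : toℕ j ≡ toℕ i ℕ.+ suc t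
    j≡i+1+t = ≡.trans (≡.sym (ℕP.m+[n∸m]≡n i<j)) (≡.sym (ℕP.+-suc (toℕ i) t))

  IsPolynomialValue-inverse : ∀ {x y} → IsPolynomialValue x → x * y ≈ 1# → IsPolynomialValue y
  IsPolynomialValue-inverse {x} {y} px xy≈1 =
    let (t , x*xᵗ≈1) = inverse-is-pow x≉0 ; (p , p≈xᵗ) = IsPolynomialValue-pow px t in
    p , trans p≈xᵗ (sym (begin
      y                   ≈⟨ *-identityʳ y ⟨
      y * 1#              ≈⟨ *-congˡ x*xᵗ≈1 ⟨
      y * (x * pow x t)   ≈⟨ *-assoc y x (pow x t) ⟨
      (y * x) * pow x t   ≈⟨ *-congʳ (trans (*-comm y x) xy≈1) ⟩
      1# * pow x t        ≈⟨ *-identityˡ _ ⟩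
      pow x t             ∎))
    where
    x≉0 : NonZero x
    x≉0 x≈0 = 1≉0 (trans (sym xy≈1) (trans (*-congʳ x≈0) (zeroˡ y)))

  IsPolynomialValue-isSubfield : IsSubfieldOverK IsPolynomialValue
  IsPolynomialValue-isSubfield = record
    { resp   = λ { e (p , px) → p , trans px e }
    ; base   = λ c → (c ∷ []) , eval-constant c
    ; +-cl   = λ { (p , px) (r , ry) → p +P r , trans (eval-+P p r) (+-cong px ry) }
    ; *-cl   = IsPolynomialValue-*
    ; neg-cl = λ { (p , px) → negP p , trans (eval-negP p) (-‿cong px) }
    ; inv-cl = IsPolynomialValue-inverse }

  α-isPolynomialValue : IsPolynomialValue α
  α-isPolynomialValue = (K.0# ∷ K.1# ∷ []) , (begin
    ι K.0# + α * eval (K.1# ∷ [])  ≈⟨ +-cong ι.0#-homo (*-congˡ (eval-constant K.1#)) ⟩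
    0# + α * ι K.1#                ≈⟨ +-identityˡ _ ⟩
    α * ι K.1#                     ≈⟨ *-congˡ ι.1#-homo ⟩
    α * 1#                         ≈⟨ *-identityʳ α ⟩
    α                              ∎)

  isPolynomialValue : ∀ x → IsPolynomialValue x
  isPolynomialValue = α-generates IsPolynomialValue IsPolynomialValue-isSubfield α-isPolynomialValue

  card≤ : ∀ {m} → (∀ x → Σ Pol λ r → DegreeBelow r m × eval r ≈ x) → Q ≤ q ^ m
  card≤ {m} represent = Counting.distinct⇒≤count _≈V_ ≈V-isEquivalence {_≈B_ = _≈_}
    (proj₁ L-card) (λ _ → tt) (proj₁ (proj₂ (proj₂ L-card))) (vectorCount m)
    coefficients (λ _ _ → tt) (λ x y _ _ e → trans (sym (value x)) (trans (eval-cong (toPol (coefficients x)) (toPol (coefficients y)) e) (value y)))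
    where
    coefficients : Carrier → Vec K.Carrier m
    coefficients x = toVec m (proj₁ (represent x))
    value : ∀ x → eval (toPol (coefficients x)) ≈ x
    value x = let (r , b , r≈x) = represent x in trans (eval-cong (toPol (toVec m r)) r (toPol-toVec m r b)) r≈x

  -- If α is a root of p of degree d + 1, every element of L has a representative with d + 1
  -- coefficients, so L has at most q^(d+1) elements.
  module _ {p d} (p-degree : HasDegree p (suc d)) (p-root : eval p ≈ 0#) where
    ReducedValue : Carrier → Set
    ReducedValue x = Σ Pol λ r → DegreeBelow r (suc d) × eval r ≈ x

    ReducedValue-α* : ∀ {x} → ReducedValue x → ReducedValue (α * x)
    ReducedValue-α* {x} (r , r-below , r≈x) =
      Xr -P (t *P p) , cancel-leading p-degree ℕP.≤-refl (DegreeBelow-∷ r-below) , value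
      where
      open import Algebra.Properties.Ring ring using (-0#≈0#)
      Xr = K.0# ∷ r
      t = monomial (suc d ∸ suc d) (coeff Xr (suc d) K.* K.inv (coeff p (suc d)) (proj₁ p-degree))
      value : eval (Xr -P (t *P p)) ≈ α * x
      value = begin
        eval (Xr -P (t *P p))            ≈⟨ eval-−P Xr (t *P p) ⟩
        eval Xr - eval (t *P p)          ≈⟨ +-congˡ (-‿cong (trans (eval-*P t p) (trans (*-congˡ p-root) (zeroʳ _)))) ⟩
        (ι K.0# + α * eval r) - 0#       ≈⟨ +-cong (+-cong ι.0#-homo (*-congˡ r≈x)) -0#≈0# ⟩
        (0# + α * x) + 0#                ≈⟨ trans (+-identityʳ _) (+-identityˡ _) ⟩
        α * x                            ∎

    reducedValue : ∀ x → ReducedValue x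
    reducedValue x = let (r , r≈x) = isPolynomialValue x ; (s , s-below , s≈r) = reduce r in
      s , s-below , trans s≈r r≈x
      where
      reduce : ∀ r → ReducedValue (eval r)
      reduce []      = [] , IsZero⇒DegreeBelow (λ _ → K.refl) , refl
      reduce (a ∷ r) =
        let (s , s-below , s≈) = ReducedValue-α* (reduce r) in
        (a ∷ []) +P s ,
        DegreeBelow-+P (DegreeBelow-mono (s≤s z≤n) (DegreeBelow-∷ (IsZero⇒DegreeBelow λ _ → K.refl))) s-below ,
        trans (eval-+P (a ∷ []) s) (+-cong (eval-constant a) s≈)

  no-root-below-2n : ∀ p → DegreeBelow p (2 ℕ.* n) → eval p ≈ 0# → IsZero p
  no-root-below-2n p below root with isZero⊎degree p
  ... | inj₁ p≈0 = p≈0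
  ... | inj₂ (zero , c≉0 , b) =
    ⊥-elim (c≉0 (ι≈0⇒≈0 (trans (sym (eval-constant _)) (trans (sym (eval-cong p (coeff p 0 ∷ []) (DegreeBelow-1⇒constant b))) root))))
  ... | inj₂ (suc d , p-degree) = ⊥-elim (ℕP.<⇒≱ (ℕP.^-monoʳ-< q 2≤q (degree<bound p-degree below))
                                                 (card≤ (reducedValue p-degree root)))

  Pol<n : Set
  Pol<n = Vec K.Carrier n

  ⟦_⟧ : Pol<n → Carrier
  ⟦ u ⟧ = eval (toPol u)

  n≤2n : n ≤ 2 ℕ.* n
  n≤2n = ℕP.m≤m+n n (n ℕ.+ 0)

  n+n≡2n : n ℕ.+ n ≡ 2 ℕ.* n
  n+n≡2n = ≡.cong (n ℕ.+_) (≡.sym (ℕP.+-identityʳ n))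

  DegreeBelow-toPol-2n : ∀ (u : Pol<n) → DegreeBelow (toPol u) (2 ℕ.* n)
  DegreeBelow-toPol-2n u = DegreeBelow-mono n≤2n (DegreeBelow-toPol u)

  DegreeBelow-*P-2n : ∀ {p r} → DegreeBelow p n → DegreeBelow r n → DegreeBelow (p *P r) (2 ℕ.* n)
  DegreeBelow-*P-2n bp br = ≡.subst (DegreeBelow _) n+n≡2n (DegreeBelow-*P bp br)

  ⟦⟧≈0⇒IsZero : ∀ u → ⟦ u ⟧ ≈ 0# → IsZero (toPol u)
  ⟦⟧≈0⇒IsZero u = no-root-below-2n (toPol u) (DegreeBelow-toPol-2n u)

  ⟦⟧-nonZero : ∀ u → ¬ IsZero (toPol u) → NonZero ⟦ u ⟧
  ⟦⟧-nonZero u u≉0 e = u≉0 (⟦⟧≈0⇒IsZero u e)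

  eval-injective : ∀ p r → DegreeBelow p (2 ℕ.* n) → DegreeBelow r (2 ℕ.* n) → eval p ≈ eval r → p ≈P r
  eval-injective p r bp br e k = K.x∙y⁻¹≈ε⇒x≈y _ _ (K.trans (K.sym (coeff-−P p r k))
    (no-root-below-2n (p -P r) (DegreeBelow-−P bp br) (trans (eval-−P p r) (x≈y⇒x∙y⁻¹≈ε e)) k))

  ⟦⟧-*-injective : ∀ u v u′ v′ → ⟦ u ⟧ * ⟦ v ⟧ ≈ ⟦ u′ ⟧ * ⟦ v′ ⟧
                 → (toPol u *P toPol v) ≈P (toPol u′ *P toPol v′)
  ⟦⟧-*-injective u v u′ v′ e = eval-injective _ _
    (DegreeBelow-*P-2n (DegreeBelow-toPol u) (DegreeBelow-toPol v))
    (DegreeBelow-*P-2n (DegreeBelow-toPol u′) (DegreeBelow-toPol v′))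
    (trans (eval-*P (toPol u) (toPol v)) (trans e (sym (eval-*P (toPol u′) (toPol v′)))))

  pairCount : HasCount (Pointwise (_≈V_ {n}) _≈V_) (λ _ → ⊤ × ⊤) (q ^ n ℕ.* q ^ n)
  pairCount = HasCount-× {_≈A_ = _≈V_} {_≈B_ = _≈V_} (vectorCount n) (vectorCount n)

  toVec-value : ∀ p → DegreeBelow p n → ⟦ toVec n p ⟧ ≈ eval p
  toVec-value p below = eval-cong (toPol (toVec n p)) p (toPol-toVec n p below)

  module Fraction (a b : Pol<n) (⟦a⟧≉0 : NonZero ⟦ a ⟧) (⟦b⟧≉0 : NonZero ⟦ b ⟧) where

    Represents : Pol<n → Pol<n → Set
    Represents u v = ⟦ u ⟧ * ⟦ b ⟧ ≈ ⟦ a ⟧ * ⟦ v ⟧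

    Represents⇒⟦⟧≈0 : ∀ u v → Represents u v → IsZero (toPol v) → ⟦ u ⟧ ≈ 0#
    Represents⇒⟦⟧≈0 u v r v≈0 = *-cancelʳ ⟦b⟧≉0 (begin
      ⟦ u ⟧ * ⟦ b ⟧  ≈⟨ r ⟩
      ⟦ a ⟧ * ⟦ v ⟧  ≈⟨ *-congˡ (eval-IsZero (toPol v) v≈0) ⟩
      ⟦ a ⟧ * 0#     ≈⟨ zeroʳ _ ⟩
      0#             ≈⟨ zeroˡ _ ⟨
      0# * ⟦ b ⟧     ∎)

    Represents-nonZero : ∀ u v → Represents u v → ¬ IsZero (toPol v) → ¬ IsZero (toPol u)
    Represents-nonZero u v r v≉0 u≈0 = v≉0 (⟦⟧≈0⇒IsZero v (x*y≈0⇒y≈0 ⟦a⟧≉0 (begin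
      ⟦ a ⟧ * ⟦ v ⟧  ≈⟨ r ⟨
      ⟦ u ⟧ * ⟦ b ⟧  ≈⟨ *-congʳ (eval-IsZero (toPol u) u≈0) ⟩
      0# * ⟦ b ⟧     ≈⟨ zeroˡ _ ⟩
      0#             ∎)))

    record MinimalRepresentation : Set where
      field
        num den    : Pol<n
        e          : ℕ
        den-degree : HasDegree (toPol den) e
        represents : Represents num den
        minimal    : ∀ u v → ¬ IsZero (toPol v) → DegreeBelow (toPol v) e → ¬ Represents u v

    RepresentsBelow : ℕ → Pol<n × Pol<n → Set
    RepresentsBelow e (u , v) = ¬ IsZero (toPol v) × DegreeBelow (toPol v) e × Represents u v

    representsBelow? : ∀ e x → Dec (RepresentsBelow e x)
    representsBelow? e (u , v) =
      ¬? (isZero? (toPol v)) ×-dec (degreeBelow? (toPol v) e ×-dec ((⟦ u ⟧ * ⟦ b ⟧) ≟ (⟦ a ⟧ * ⟦ v ⟧)))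

    RepresentsBelow-resp : ∀ e {x y} → Pointwise _≈V_ _≈V_ x y → RepresentsBelow e x → RepresentsBelow e y
    RepresentsBelow-resp e {u , v} {u′ , v′} (u≈ , v≈) (v≉0 , below , r) =
      (λ z → v≉0 (λ k → K.trans (v≈ k) (z k))) , DegreeBelow-cong v≈ below ,
      trans (*-congʳ (sym (eval-cong (toPol u) (toPol u′) u≈))) (trans r (*-congˡ (eval-cong (toPol v) (toPol v′) v≈)))

    private
      pairs = proj₁ pairCount
      pairs-cover = proj₂ (proj₂ (proj₂ pairCount))

    -- Exhaustive search over all pairs for a representation with a denominator of smaller degree.
    minimise : ∀ M u v → Represents u v → ¬ IsZero (toPol v) → DegreeBelow (toPol v) M → MinimalRepresentation
    minimise zero    u v r v≉0 below = ⊥-elim (v≉0 (DegreeBelow-0⇒IsZero below))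
    minimise (suc M) u v r v≉0 below with degree (toPol v) v≉0
    ... | e , v-degree with FinP.any? (λ i → representsBelow? e (lookup pairs i))
    ...   | yes (i , (v′≉0 , below′ , r′)) = minimise M (proj₁ (lookup pairs i)) (proj₂ (lookup pairs i)) r′ v′≉0
            (DegreeBelow-mono (ℕP.≤-pred (degree<bound v-degree below)) below′)
    ...   | no none = record
            { num = u ; den = v ; e = e ; den-degree = v-degree ; represents = r
            ; minimal = λ u′ v′ v′≉0 below′ r′ → let (i , eq) = pairs-cover (u′ , v′) (tt , tt) in
                none (i , RepresentsBelow-resp e {u′ , v′} {lookup pairs i} eq (v′≉0 , below′ , r′)) }

    -- Only the fields matter; unfolding the search would be expensive.
    opaque
      minimalRepresentation : MinimalRepresentation
      minimalRepresentation = minimise n a b refl (λ z → ⟦b⟧≉0 (eval-IsZero (toPol b) z)) (DegreeBelow-toPol b)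

    open MinimalRepresentation minimalRepresentation

    lead : K.Carrier
    lead = coeff (toPol den) e

    lead≉0 : K.NonZero lead
    lead≉0 = proj₁ den-degree

    Represents⇒cross : ∀ u v → Represents u v → ⟦ u ⟧ * ⟦ den ⟧ ≈ ⟦ num ⟧ * ⟦ v ⟧
    Represents⇒cross u v r = *-cancelʳ ⟦b⟧≉0 (begin
      (⟦ u ⟧ * ⟦ den ⟧) * ⟦ b ⟧  ≈⟨ solve 3 (λ x y z → (x :* y) :* z := y :* (x :* z)) refl ⟦ u ⟧ ⟦ den ⟧ ⟦ b ⟧ ⟩
      ⟦ den ⟧ * (⟦ u ⟧ * ⟦ b ⟧)  ≈⟨ *-congˡ r ⟩
      ⟦ den ⟧ * (⟦ a ⟧ * ⟦ v ⟧)  ≈⟨ solve 3 (λ x y z → y :* (x :* z) := z :* (x :* y)) refl ⟦ a ⟧ ⟦ den ⟧ ⟦ v ⟧ ⟩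
      ⟦ v ⟧ * (⟦ a ⟧ * ⟦ den ⟧)  ≈⟨ *-congˡ represents ⟨
      ⟦ v ⟧ * (⟦ num ⟧ * ⟦ b ⟧)  ≈⟨ solve 3 (λ x y z → x :* (y :* z) := (y :* x) :* z) refl ⟦ v ⟧ ⟦ num ⟧ ⟦ b ⟧ ⟩
      (⟦ num ⟧ * ⟦ v ⟧) * ⟦ b ⟧  ∎)

    IsMultiple : ℕ → Pol<n → Pol<n → Set
    IsMultiple M u v = Σ Pol λ s → DegreeBelow s M × (eval s * ⟦ num ⟧ ≈ ⟦ u ⟧) × (eval s * ⟦ den ⟧ ≈ ⟦ v ⟧)

    -- Comparing degrees in u · den = num · v gives deg u = (M - e) + deg num.
    shifted-num-below : ∀ {M} u v → Represents u v → HasDegree (toPol v) M → e ≤ M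
                      → ∀ c → DegreeBelow (monomial (M ∸ e) c *P toPol num) n
    shifted-num-below {M} u v r v-degree e≤M c =
      DegreeBelow-mono (≡.subst (λ d → suc d ≤ n) du≡ (degree<bound (proj₂ u-degree) (DegreeBelow-toPol u)))
        (proj₁ (leading-*P (monomial (M ∸ e) c) (toPol num) (M ∸ e) d₁
                           (DegreeBelow-monomial (M ∸ e) c) (proj₂ (proj₂ num-degree))))
      where
      open import Data.Nat.Tactic.RingSolver using () renaming (solve-∀ to solveℕ)
      u-degree = degree (toPol u) (Represents-nonZero u v r (HasDegree⇒¬IsZero v-degree))
      num-degree = degree (toPol num) (Represents-nonZero num den represents (HasDegree⇒¬IsZero den-degree))
      d₁ = proj₁ num-degree
      du = proj₁ u-degree
      degrees : du ℕ.+ e ≡ d₁ ℕ.+ M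
      degrees = degree-unique
        (HasDegree-cong (⟦⟧-*-injective u den num v (Represents⇒cross u v r)) (HasDegree-*P (proj₂ u-degree) den-degree))
        (HasDegree-*P (proj₂ num-degree) v-degree)
      rearrange : ∀ d k e → d ℕ.+ (k ℕ.+ e) ≡ (k ℕ.+ d) ℕ.+ e
      rearrange = solveℕ
      du≡ : du ≡ (M ∸ e) ℕ.+ d₁
      du≡ = ℕP.+-cancelʳ-≡ e du _ (≡.trans degrees
              (≡.trans (≡.cong (d₁ ℕ.+_) (≡.sym (ℕP.m∸n+n≡m e≤M))) (rearrange d₁ (M ∸ e) e)))

    Represents-subtract : ∀ u v u′ v′ T → Represents u v → ⟦ u′ ⟧ ≈ ⟦ u ⟧ - T * ⟦ num ⟧ → ⟦ v′ ⟧ ≈ ⟦ v ⟧ - T * ⟦ den ⟧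
                        → Represents u′ v′
    Represents-subtract u v u′ v′ T r ⟦u′⟧ ⟦v′⟧ = begin
      ⟦ u′ ⟧ * ⟦ b ⟧                                 ≈⟨ *-congʳ ⟦u′⟧ ⟩
      (⟦ u ⟧ - T * ⟦ num ⟧) * ⟦ b ⟧                  ≈⟨ solve 4 (λ x z B T → (x :- T :* z) :* B := x :* B :- T :* (z :* B))
                                                         refl ⟦ u ⟧ ⟦ num ⟧ ⟦ b ⟧ T ⟩
      ⟦ u ⟧ * ⟦ b ⟧ - T * (⟦ num ⟧ * ⟦ b ⟧)          ≈⟨ +-cong r (-‿cong (*-congˡ represents)) ⟩
      ⟦ a ⟧ * ⟦ v ⟧ - T * (⟦ a ⟧ * ⟦ den ⟧)          ≈⟨ solve 4 (λ y w A T → A :* y :- T :* (A :* w) := A :* (y :- T :* w))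
                                                         refl ⟦ v ⟧ ⟦ den ⟧ ⟦ a ⟧ T ⟩
      ⟦ a ⟧ * (⟦ v ⟧ - T * ⟦ den ⟧)                  ≈⟨ *-congˡ ⟦v′⟧ ⟨
      ⟦ a ⟧ * ⟦ v′ ⟧                                 ∎

    -- One step of long division of (u , v) by (num , den).
    divide-step : ∀ {M} u v → Represents u v → HasDegree (toPol v) M → e ≤ M
                → (∀ u′ v′ → Represents u′ v′ → DegreeBelow (toPol v′) M → IsMultiple M u′ v′)
                → IsMultiple (suc M) u v
    divide-step {M} u v r v-degree e≤M recurse =
      let (s , s-below , s-num , s-den) = recurse u′ v′ (Represents-subtract u v u′ v′ T r ⟦u′⟧ ⟦v′⟧) v′-below in
      s +P t , DegreeBelow-+P (DegreeBelow-mono (ℕP.n≤1+n M) s-below) t-below ,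
      add-back s ⟦u′⟧ s-num , add-back s ⟦v′⟧ s-den
      where
      c = coeff (toPol v) M K.* K.inv lead lead≉0
      t = monomial (M ∸ e) c
      T = eval t
      t-below : DegreeBelow t (suc M)
      t-below = DegreeBelow-mono (s≤s (ℕP.m∸n≤m M e)) (DegreeBelow-monomial (M ∸ e) c)
      M≤n : M ≤ n
      M≤n = ℕP.<⇒≤ (degree<bound v-degree (DegreeBelow-toPol v))
      u₀ = toPol u -P (t *P toPol num)
      v₀ = toPol v -P (t *P toPol den)
      v₀-below : DegreeBelow v₀ M
      v₀-below = cancel-leading den-degree e≤M (proj₂ v-degree)
      u′ = toVec n u₀
      v′ = toVec n v₀
      ⟦u′⟧ : ⟦ u′ ⟧ ≈ ⟦ u ⟧ - T * ⟦ num ⟧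
      ⟦u′⟧ = trans (toVec-value u₀ (DegreeBelow-−P (DegreeBelow-toPol u) (shifted-num-below u v r v-degree e≤M c)))
               (trans (eval-−P (toPol u) (t *P toPol num)) (+-congˡ (-‿cong (eval-*P t (toPol num)))))
      ⟦v′⟧ : ⟦ v′ ⟧ ≈ ⟦ v ⟧ - T * ⟦ den ⟧
      ⟦v′⟧ = trans (toVec-value v₀ (DegreeBelow-mono M≤n v₀-below))
               (trans (eval-−P (toPol v) (t *P toPol den)) (+-congˡ (-‿cong (eval-*P t (toPol den)))))
      v′-below : DegreeBelow (toPol v′) M
      v′-below = DegreeBelow-cong (≈P-sym {toPol v′} {v₀} (toPol-toVec n v₀ (DegreeBelow-mono M≤n v₀-below))) v₀-below
      add-back : ∀ s {X Y Z} → Y ≈ Z - T * X → eval s * X ≈ Y → eval (s +P t) * X ≈ Z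
      add-back s {X} {Y} {Z} Y≈ sX≈Y = begin
        eval (s +P t) * X        ≈⟨ *-congʳ (eval-+P s t) ⟩
        (eval s + T) * X         ≈⟨ distribʳ X (eval s) T ⟩
        eval s * X + T * X       ≈⟨ +-congʳ (trans sX≈Y Y≈) ⟩
        (Z - T * X) + T * X      ≈⟨ solve 3 (λ Z T X → (Z :- T :* X) :+ T :* X := Z) refl Z T X ⟩
        Z                        ∎

    isMultiple : ∀ M u v → Represents u v → DegreeBelow (toPol v) M → IsMultiple M u v
    isMultiple zero    u v r below = [] , IsZero⇒DegreeBelow (λ _ → K.refl) ,
      trans (zeroˡ _) (sym (Represents⇒⟦⟧≈0 u v r v≈0)) , trans (zeroˡ _) (sym (eval-IsZero (toPol v) v≈0))
      where v≈0 = DegreeBelow-0⇒IsZero below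
    isMultiple (suc M) u v r below with coeff (toPol v) M K.≟ K.0#
    ... | yes top≈0 = let (s , s-below , s-num , s-den) = isMultiple M u v r (DegreeBelow-pred below top≈0) in
                      s , DegreeBelow-mono (ℕP.n≤1+n M) s-below , s-num , s-den
    ... | no top≉0 with M ℕP.<? e
    ...   | yes M<e = ⊥-elim (minimal u v (HasDegree⇒¬IsZero (top≉0 , below)) (DegreeBelow-mono M<e below) r)
    ...   | no M≮e  = divide-step u v r (top≉0 , below) (ℕP.≮⇒≥ M≮e) (isMultiple M)

    reduced⇒scaled : ∀ h₁ h₂ → NuPair (h₁ , h₂) → Represents h₁ h₂
                   → Σ K.Carrier λ c → (c K.* lead K.≈ K.1#)
                       × (toPol h₁ ≈P scaleP c (toPol num)) × (toPol h₂ ≈P scaleP c (toPol den))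
    reduced⇒scaled h₁ h₂ (_ , _ , h₂-monic , h-coprime) r with isMultiple n h₁ h₂ r (DegreeBelow-toPol h₂)
    ... | s , s-below , s-num , s-den = c , c*lead≈1 , scaled h₁ num s*num≈h₁ , scaled h₂ den s*den≈h₂
      where
      s*num≈h₁ : (s *P toPol num) ≈P toPol h₁
      s*num≈h₁ = eval-injective (s *P toPol num) (toPol h₁) (DegreeBelow-*P-2n s-below (DegreeBelow-toPol num)) (DegreeBelow-toPol-2n h₁)
                   (trans (eval-*P s (toPol num)) s-num)
      s*den≈h₂ : (s *P toPol den) ≈P toPol h₂
      s*den≈h₂ = eval-injective (s *P toPol den) (toPol h₂) (DegreeBelow-*P-2n s-below (DegreeBelow-toPol den)) (DegreeBelow-toPol-2n h₂)
                   (trans (eval-*P s (toPol den)) s-den)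
      s-constant : HasDegree s 0
      s-constant = ∣oneP⇒HasDegree-0 (h-coprime s (toPol num , s*num≈h₁) (toPol den , s*den≈h₂))
      c = coeff s 0
      scaled : ∀ h m → (s *P toPol m) ≈P toPol h → toPol h ≈P scaleP c (toPol m)
      scaled h m s*m≈h k = K.trans (K.sym (s*m≈h k))
        (K.trans (coeff-constant-*P s (toPol m) k (proj₂ s-constant)) (K.sym (coeff-scaleP c (toPol m) k)))
      h₂-degree : HasDegree (toPol h₂) e
      h₂-degree = HasDegree-cong {scaleP c (toPol den)} {toPol h₂} (≈P-sym {toPol h₂} {scaleP c (toPol den)} (scaled h₂ den s*den≈h₂))
                    (HasDegree-scaleP (proj₁ s-constant) den-degree)
      c*lead≈1 : c K.* lead K.≈ K.1#
      c*lead≈1 = K.trans (K.sym (coeff-scaleP c (toPol den) e))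
        (K.trans (K.sym (scaled h₂ den s*den≈h₂ e))
          (≡.subst (λ d → coeff (toPol h₂) d K.≈ K.1#) (degree-unique (Monic⇒HasDegree h₂-monic) h₂-degree)
                   (proj₁ (proj₂ h₂-monic))))

    Represents-cancel : ∀ f₁ f₂ d h₁ h₂ → Represents f₁ f₂ → NonZero (eval d)
                      → (d *P h₁) ≈P toPol f₁ → (d *P h₂) ≈P toPol f₂ → eval h₁ * ⟦ b ⟧ ≈ ⟦ a ⟧ * eval h₂
    Represents-cancel f₁ f₂ d h₁ h₂ r D≉0 d*h₁≈f₁ d*h₂≈f₂ = *-cancelˡ D≉0 (begin
      D * (eval h₁ * ⟦ b ⟧)   ≈⟨ *-assoc D (eval h₁) ⟦ b ⟧ ⟨
      (D * eval h₁) * ⟦ b ⟧   ≈⟨ *-congʳ (D*H≈ h₁ f₁ d*h₁≈f₁) ⟩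
      ⟦ f₁ ⟧ * ⟦ b ⟧          ≈⟨ r ⟩
      ⟦ a ⟧ * ⟦ f₂ ⟧          ≈⟨ *-congˡ (D*H≈ h₂ f₂ d*h₂≈f₂) ⟨
      ⟦ a ⟧ * (D * eval h₂)   ≈⟨ solve 3 (λ x y z → x :* (y :* z) := y :* (x :* z)) refl ⟦ a ⟧ D (eval h₂) ⟩
      D * (⟦ a ⟧ * eval h₂)   ∎)
      where
      D = eval d
      D*H≈ : ∀ h f → (d *P h) ≈P toPol f → D * eval h ≈ ⟦ f ⟧
      D*H≈ h f d*h≈f = trans (sym (eval-*P d h)) (eval-cong (d *P h) (toPol f) d*h≈f)

    -- Cancelling a common factor of positive degree would leave a denominator of degree below e.
    minimal-degree⇒coprime : ∀ f₁ f₂ → Represents f₁ f₂ → HasDegree (toPol f₂) e → Coprime (toPol f₁) (toPol f₂)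
    minimal-degree⇒coprime f₁ f₂ r f₂-degree d (h₁ , d*h₁≈f₁) (h₂ , d*h₂≈f₂) with isZero⊎degree d
    ... | inj₁ d≈0 = ⊥-elim (HasDegree⇒¬IsZero f₂-degree (λ k → K.trans (K.sym (d*h₂≈f₂ k)) (IsZero-*Pˡ d h₂ d≈0 k)))
    ... | inj₂ (zero  , d-degree) = HasDegree-0⇒∣oneP d-degree
    ... | inj₂ (suc k , d-degree) = ⊥-elim (minimal (toVec n h₁) (toVec n h₂) h₂′≉0 h₂′-below
          (trans (*-congʳ ⟦h₁′⟧) (trans (Represents-cancel f₁ f₂ d h₁ h₂ r D≉0 d*h₁≈f₁ d*h₂≈f₂) (*-congˡ (sym ⟦h₂′⟧)))))
      where
      h₁-below : DegreeBelow h₁ n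
      h₁-below = DegreeBelow-mono (ℕP.n≤1+n n′) (cofactor-below d-degree d*h₁≈f₁ (DegreeBelow-toPol f₁))
      h₂-below : DegreeBelow h₂ n
      h₂-below = DegreeBelow-mono (ℕP.<⇒≤ (degree<bound f₂-degree (DegreeBelow-toPol f₂)))
                   (cofactor-below d-degree d*h₂≈f₂ (proj₂ f₂-degree))
      ⟦h₁′⟧ : ⟦ toVec n h₁ ⟧ ≈ eval h₁
      ⟦h₁′⟧ = toVec-value h₁ h₁-below
      ⟦h₂′⟧ : ⟦ toVec n h₂ ⟧ ≈ eval h₂
      ⟦h₂′⟧ = toVec-value h₂ h₂-below
      h₂′-below : DegreeBelow (toPol (toVec n h₂)) e
      h₂′-below = DegreeBelow-cong (≈P-sym {toPol (toVec n h₂)} {h₂} (toPol-toVec n h₂ h₂-below))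
                    (cofactor-below d-degree d*h₂≈f₂ (proj₂ f₂-degree))
      f₂≉0 = HasDegree⇒¬IsZero f₂-degree
      D*H₂≈0⇒⊥ : eval d * eval h₂ ≈ 0# → ⊥
      D*H₂≈0⇒⊥ D*H₂≈0 = f₂≉0 (⟦⟧≈0⇒IsZero f₂
        (trans (sym (eval-cong (d *P h₂) (toPol f₂) d*h₂≈f₂)) (trans (eval-*P d h₂) D*H₂≈0)))
      D≉0 : NonZero (eval d)
      D≉0 D≈0 = D*H₂≈0⇒⊥ (trans (*-congʳ D≈0) (zeroˡ _))
      h₂′≉0 : ¬ IsZero (toPol (toVec n h₂))
      h₂′≉0 z = D*H₂≈0⇒⊥ (trans (*-congˡ (trans (sym ⟦h₂′⟧) (eval-IsZero (toPol (toVec n h₂)) z))) (zeroʳ _))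

    reduced-unique : NuPair (a , b) → ∀ g₁ g₂ → NuPair (g₁ , g₂) → Represents g₁ g₂ → VecPairEq (a , b) (g₁ , g₂)
    reduced-unique ab-reduced g₁ g₂ g-reduced g-represents =
      same {toPol a} {toPol g₁} {toPol num} (proj₁ a,b≈) (proj₁ g≈) , same {toPol b} {toPol g₂} {toPol den} (proj₂ a,b≈) (proj₂ g≈)
      where
      ab-scaled = reduced⇒scaled a b ab-reduced refl
      g-scaled = reduced⇒scaled g₁ g₂ g-reduced g-represents
      c = proj₁ ab-scaled
      c′ = proj₁ g-scaled
      a,b≈ = proj₂ (proj₂ ab-scaled)
      g≈ = proj₂ (proj₂ g-scaled)
      c≈c′ : c K.≈ c′
      c≈c′ = K.*-cancelʳ lead≉0 (K.trans (proj₁ (proj₂ ab-scaled)) (K.sym (proj₁ (proj₂ g-scaled))))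
      same : ∀ {f g m} → f ≈P scaleP c m → g ≈P scaleP c′ m → f ≈P g
      same {m = m} f≈ g≈ k = K.trans (f≈ k) (K.trans (coeff-scaleP c m k)
        (K.trans (K.*-congʳ c≈c′) (K.trans (K.sym (coeff-scaleP c′ m k)) (K.sym (g≈ k)))))

    reduced-representation : Σ (Pol<n × Pol<n) λ f → NuPair f × Represents (proj₁ f) (proj₂ f)
    reduced-representation = (f₁ , f₂) , (f₁≉0 , HasDegree⇒¬IsZero f₂-degree , f₂-monic , coprime) , f-represents
      where
      w = K.inv lead lead≉0
      W = ι w
      f₁ = Vec.map (w K.*_) num
      f₂ = Vec.map (w K.*_) den
      toPol-scaled : ∀ u → toPol (Vec.map (w K.*_) u) ≈P scaleP w (toPol u)
      toPol-scaled u k = K.reflexive (≡.cong (λ p → coeff p k) (toPol-map (w K.*_) u))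
      ⟦scaled⟧ : ∀ u → ⟦ Vec.map (w K.*_) u ⟧ ≈ W * ⟦ u ⟧
      ⟦scaled⟧ u = trans (eval-cong (toPol (Vec.map (w K.*_) u)) (scaleP w (toPol u)) (toPol-scaled u)) (eval-scaleP w (toPol u))
      f₂-degree : HasDegree (toPol f₂) e
      f₂-degree = HasDegree-cong {scaleP w (toPol den)} {toPol f₂} (≈P-sym {toPol f₂} {scaleP w (toPol den)} (toPol-scaled den))
                    (HasDegree-scaleP (K.inv-nonZero lead lead≉0) den-degree)
      f₂-monic : Monic (toPol f₂)
      f₂-monic = e , K.trans (toPol-scaled den e) (K.trans (coeff-scaleP w (toPol den) e) (K.*-inverseˡ lead lead≉0)) ,
                 vanishes (proj₂ f₂-degree)
      f₁≉0 : ¬ IsZero (toPol f₁)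
      f₁≉0 z = Represents-nonZero num den represents (HasDegree⇒¬IsZero den-degree) (⟦⟧≈0⇒IsZero num
        (x*y≈0⇒y≈0 (ι-nonZero (K.inv-nonZero lead lead≉0)) (trans (sym (⟦scaled⟧ num)) (eval-IsZero (toPol f₁) z))))
      f-represents : Represents f₁ f₂
      f-represents = begin
        ⟦ f₁ ⟧ * ⟦ b ⟧           ≈⟨ *-congʳ (⟦scaled⟧ num) ⟩
        (W * ⟦ num ⟧) * ⟦ b ⟧    ≈⟨ *-assoc W ⟦ num ⟧ ⟦ b ⟧ ⟩
        W * (⟦ num ⟧ * ⟦ b ⟧)    ≈⟨ *-congˡ represents ⟩
        W * (⟦ a ⟧ * ⟦ den ⟧)    ≈⟨ solve 3 (λ x y z → x :* (y :* z) := y :* (x :* z)) refl W ⟦ a ⟧ ⟦ den ⟧ ⟩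
        ⟦ a ⟧ * (W * ⟦ den ⟧)    ≈⟨ *-congˡ (⟦scaled⟧ den) ⟨
        ⟦ a ⟧ * ⟦ f₂ ⟧           ∎
      coprime : Coprime (toPol f₁) (toPol f₂)
      coprime = minimal-degree⇒coprime f₁ f₂ f-represents f₂-degree

  module GoodPairs (ν : ℕ) (ν-count : HasCount (VecPairEq {n}) (NuPair {n}) ν) where
    open Extension K L ι using (lincomb; family; GoodPair; PairEq)
    open import Algebra.Properties.Semiring.Sum semiring using (sum; sum-cong-≋; ∑-distrib-+; *-distribʳ-sum; *-distribˡ-sum)

    sum-powers : ∀ {m} (g : Fin m → K.Carrier) → sum (λ i → ι (g i) * pow α (toℕ i)) ≈ eval (toPol (tabulate g))
    sum-powers {zero}  g = refl
    sum-powers {suc m} g = +-cong (*-identityʳ _) (begin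
      sum (λ i → ι (g (suc i)) * (α * pow α (toℕ i)))   ≈⟨ sum-cong-≋ (λ i → solve 3 (λ x y z → x :* (y :* z) := y :* (x :* z)) refl (ι (g (suc i))) α (pow α (toℕ i))) ⟩
      sum (λ i → α * (ι (g (suc i)) * pow α (toℕ i)))   ≈⟨ *-distribˡ-sum α (λ i → ι (g (suc i)) * pow α (toℕ i)) ⟨
      α * sum (λ i → ι (g (suc i)) * pow α (toℕ i))     ≈⟨ *-congˡ (sum-powers (λ i → g (suc i))) ⟩
      α * eval (toPol (tabulate (λ i → g (suc i))))     ∎)

    column : (Fin n → Fin 2 → K.Carrier) → Fin 2 → Pol<n
    column c j = tabulate (λ i → c i j)

    lincomb-family : ∀ c v₁ v₂ → lincomb c (family n α v₁ v₂) ≈ ⟦ column c zero ⟧ * v₁ + ⟦ column c (suc zero) ⟧ * v₂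
    lincomb-family c v₁ v₂ = begin
      lincomb c (family n α v₁ v₂)                ≈⟨ sum-cong-≋ (λ i → solve 5 (λ a b p u v → a :* (p :* u) :+ (b :* (p :* v) :+ con (+ 0)) := (a :* p) :* u :+ (b :* p) :* v)
                                                        refl (ι (c i zero)) (ι (c i (suc zero))) (pow α (toℕ i)) v₁ v₂) ⟩
      sum (λ i → x i * v₁ + y i * v₂)             ≈⟨ ∑-distrib-+ (λ i → x i * v₁) (λ i → y i * v₂) ⟩
      sum (λ i → x i * v₁) + sum (λ i → y i * v₂) ≈⟨ +-cong (*-distribʳ-sum v₁ x) (*-distribʳ-sum v₂ y) ⟨
      sum x * v₁ + sum y * v₂                     ≈⟨ +-cong (*-congʳ (sum-powers (λ i → c i zero))) (*-congʳ (sum-powers (λ i → c i (suc zero)))) ⟩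
      ⟦ column c zero ⟧ * v₁ + ⟦ column c (suc zero) ⟧ * v₂ ∎
      where
      x y : Fin n → Carrier
      x i = ι (c i zero) * pow α (toℕ i)
      y i = ι (c i (suc zero)) * pow α (toℕ i)

    coefficients : Pol<n → Pol<n → Fin n → Fin 2 → K.Carrier
    coefficients u₀ u₁ i zero    = lookup u₀ i
    coefficients u₀ u₁ i (suc _) = lookup u₁ i

    lincomb-coefficients : ∀ u₀ u₁ v₁ v₂ → lincomb (coefficients u₀ u₁) (family n α v₁ v₂) ≈ ⟦ u₀ ⟧ * v₁ + ⟦ u₁ ⟧ * v₂
    lincomb-coefficients u₀ u₁ v₁ v₂ = trans (lincomb-family (coefficients u₀ u₁) v₁ v₂)
      (≡.subst₂ (λ x y → ⟦ x ⟧ * v₁ + ⟦ y ⟧ * v₂ ≈ ⟦ u₀ ⟧ * v₁ + ⟦ u₁ ⟧ * v₂)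
                (≡.sym (VecP.tabulate∘lookup u₀)) (≡.sym (VecP.tabulate∘lookup u₁)) refl)

    zeros : ∀ {m} → Vec K.Carrier m
    zeros = Vec.replicate _ K.0#

    eval-zeros : ∀ m → eval (toPol (zeros {m})) ≈ 0#
    eval-zeros m = eval-IsZero (toPol (zeros {m})) (IsZero-toPol (zeros {m}) (λ i → K.reflexive (VecP.lookup-replicate i K.0#)))

    one : Pol<n
    one = K.1# ∷ zeros

    ⟦one⟧ : ⟦ one ⟧ ≈ 1#
    ⟦one⟧ = trans (+-cong ι.1#-homo (trans (*-congˡ (eval-zeros n′)) (zeroʳ α))) (+-identityʳ 1#)

    negate : Pol<n → Pol<n
    negate = Vec.map (λ x → K.- x)

    ⟦negate⟧ : ∀ u → ⟦ negate u ⟧ ≈ - ⟦ u ⟧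
    ⟦negate⟧ u = ≡.subst (λ p → eval p ≈ - ⟦ u ⟧) (≡.sym (toPol-map (λ x → K.- x) u)) (eval-negP (toPol u))

    private
      pairs          = proj₁ ν-count
      pairs-reduced  = proj₁ (proj₂ ν-count)
      pairs-distinct = proj₁ (proj₂ (proj₂ ν-count))
      pairs-cover    = proj₂ (proj₂ (proj₂ ν-count))

    Exceptional : Carrier → Set
    Exceptional y = (y ≈ 0#) ⊎ ∃ λ f → NuPair f × y * ⟦ proj₂ f ⟧ ≈ ⟦ proj₁ f ⟧

    Exceptional-resp : ∀ {x y} → x ≈ y → Exceptional x → Exceptional y
    Exceptional-resp x≈y (inj₁ x≈0)              = inj₁ (trans (sym x≈y) x≈0)
    Exceptional-resp x≈y (inj₂ (f , f-reduced , e)) = inj₂ (f , f-reduced , trans (*-congʳ (sym x≈y)) e)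

    exceptional? : ∀ y → Dec (Exceptional y)
    exceptional? y with y ≟ 0# | FinP.any? (λ i → (y * ⟦ proj₂ (lookup pairs i) ⟧) ≟ ⟦ proj₁ (lookup pairs i) ⟧)
    ... | yes y≈0 | _           = yes (inj₁ y≈0)
    ... | no _    | yes (i , e) = yes (inj₂ (lookup pairs i , pairs-reduced i , e))
    ... | no y≉0  | no none     = no λ
      { (inj₁ y≈0) → y≉0 y≈0
      ; (inj₂ ((f₁ , f₂) , f-reduced , e)) → let (i , f₁≈ , f₂≈) = pairs-cover (f₁ , f₂) f-reduced in
          none (i , trans (*-congˡ (sym (eval-cong (toPol f₂) (toPol (proj₂ (lookup pairs i))) f₂≈)))
                         (trans e (eval-cong (toPol f₁) (toPol (proj₁ (lookup pairs i))) f₁≈))) }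

    ratio⇒exceptional : ∀ {y} u v → ¬ IsZero (toPol u) → ¬ IsZero (toPol v) → y * ⟦ v ⟧ ≈ ⟦ u ⟧ → Exceptional y
    ratio⇒exceptional {y} u v u≉0 v≉0 y*v≈u = inj₂ (f , f-reduced , y*f₂≈f₁)
      where
      open Fraction u v (⟦⟧-nonZero u u≉0) (⟦⟧-nonZero v v≉0) using (reduced-representation)
      f = proj₁ reduced-representation
      f-reduced = proj₁ (proj₂ reduced-representation)
      y*f₂≈f₁ : y * ⟦ proj₂ f ⟧ ≈ ⟦ proj₁ f ⟧
      y*f₂≈f₁ = *-cancelʳ (⟦⟧-nonZero v v≉0) (begin
        (y * ⟦ proj₂ f ⟧) * ⟦ v ⟧    ≈⟨ solve 3 (λ x y z → (x :* y) :* z := y :* (x :* z)) refl y ⟦ proj₂ f ⟧ ⟦ v ⟧ ⟩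
        ⟦ proj₂ f ⟧ * (y * ⟦ v ⟧)    ≈⟨ *-congˡ y*v≈u ⟩
        ⟦ proj₂ f ⟧ * ⟦ u ⟧          ≈⟨ *-comm _ _ ⟩
        ⟦ u ⟧ * ⟦ proj₂ f ⟧          ≈⟨ proj₂ (proj₂ reduced-representation) ⟨
        ⟦ proj₁ f ⟧ * ⟦ v ⟧          ∎)

    unexceptional-independent : ∀ {y} → ¬ Exceptional y → ∀ u₀ u₁ → ⟦ u₀ ⟧ * y + ⟦ u₁ ⟧ ≈ 0#
                              → IsZero (toPol u₀) × IsZero (toPol u₁)
    unexceptional-independent {y} ¬exc u₀ u₁ e with isZero? (toPol u₀) | isZero? (toPol u₁)
    ... | yes u₀≈0 | _ = u₀≈0 , ⟦⟧≈0⇒IsZero u₁ (begin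
      ⟦ u₁ ⟧                 ≈⟨ +-identityˡ _ ⟨
      0# + ⟦ u₁ ⟧            ≈⟨ +-congʳ (trans (*-congʳ (eval-IsZero (toPol u₀) u₀≈0)) (zeroˡ y)) ⟨
      ⟦ u₀ ⟧ * y + ⟦ u₁ ⟧    ≈⟨ e ⟩
      0#                     ∎)
    ... | no u₀≉0 | yes u₁≈0 = ⊥-elim (¬exc (inj₁ (x*y≈0⇒y≈0 (⟦⟧-nonZero u₀ u₀≉0) (begin
      ⟦ u₀ ⟧ * y             ≈⟨ +-identityʳ _ ⟨
      ⟦ u₀ ⟧ * y + 0#        ≈⟨ +-congˡ (eval-IsZero (toPol u₁) u₁≈0) ⟨
      ⟦ u₀ ⟧ * y + ⟦ u₁ ⟧    ≈⟨ e ⟩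
      0#                     ∎))))
    ... | no u₀≉0 | no u₁≉0 = ⊥-elim (¬exc (ratio⇒exceptional (negate u₁) u₀ −u₁≉0 u₀≉0 (begin
      y * ⟦ u₀ ⟧             ≈⟨ *-comm y ⟦ u₀ ⟧ ⟩
      ⟦ u₀ ⟧ * y             ≈⟨ x∙y⁻¹≈ε⇒x≈y _ _ (trans (+-congˡ (-‿involutive ⟦ u₁ ⟧)) e) ⟩
      - ⟦ u₁ ⟧               ≈⟨ ⟦negate⟧ u₁ ⟨
      ⟦ negate u₁ ⟧          ∎)))
      where
      open import Algebra.Properties.Ring ring using (-‿involutive)
      −u₁≉0 : ¬ IsZero (toPol (negate u₁))
      −u₁≉0 z = u₁≉0 (⟦⟧≈0⇒IsZero u₁ (trans (sym (-‿involutive _))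
                  (trans (-‿cong (trans (sym (⟦negate⟧ u₁)) (eval-IsZero (toPol (negate u₁)) z))) -0#≈0#)))
        where open import Algebra.Properties.Ring ring using (-0#≈0#)

    Good : Carrier → Carrier → Set
    Good v₁ v₂ = GoodPair n α (v₁ , v₂)

    good⇒nonZero : ∀ {v₁ v₂} → Good v₁ v₂ → NonZero v₂
    good⇒nonZero {v₁} {v₂} (independent , _) v₂≈0 =
      K.1≉0 (independent (coefficients zeros one) combination zero (suc zero))
      where
      combination : lincomb (coefficients zeros one) (family n α v₁ v₂) ≈ 0#
      combination = begin
        lincomb (coefficients zeros one) (family n α v₁ v₂) ≈⟨ lincomb-coefficients zeros one v₁ v₂ ⟩
        ⟦ zeros ⟧ * v₁ + ⟦ one ⟧ * v₂                      ≈⟨ +-cong (*-congʳ (eval-zeros n)) (*-cong ⟦one⟧ v₂≈0) ⟩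
        0# * v₁ + 1# * 0#                                  ≈⟨ +-cong (zeroˡ v₁) (zeroʳ 1#) ⟩
        0# + 0#                                            ≈⟨ +-identityˡ 0# ⟩
        0#                                                 ∎

    good⇒unexceptional : ∀ {v₁ v₂ y} → Good v₁ v₂ → v₁ ≈ y * v₂ → ¬ Exceptional y
    good⇒unexceptional {v₁} {v₂} {y} (independent , _) v₁≈ (inj₁ y≈0) =
      K.1≉0 (independent (coefficients one zeros) combination zero zero)
      where
      combination : lincomb (coefficients one zeros) (family n α v₁ v₂) ≈ 0#
      combination = begin
        lincomb (coefficients one zeros) (family n α v₁ v₂) ≈⟨ lincomb-coefficients one zeros v₁ v₂ ⟩
        ⟦ one ⟧ * v₁ + ⟦ zeros ⟧ * v₂                      ≈⟨ +-cong (*-cong ⟦one⟧ v₁≈) (*-congʳ (eval-zeros n)) ⟩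
        1# * (y * v₂) + 0# * v₂                            ≈⟨ +-cong (*-congˡ (*-congʳ y≈0)) (zeroˡ v₂) ⟩
        1# * (0# * v₂) + 0#                                ≈⟨ trans (+-identityʳ _) (trans (*-congˡ (zeroˡ v₂)) (zeroʳ 1#)) ⟩
        0#                                                 ∎
    good⇒unexceptional {v₁} {v₂} {y} (independent , _) v₁≈ (inj₂ ((f₁ , f₂) , (_ , f₂≉0 , _) , y*f₂≈f₁)) =
      f₂≉0 (IsZero-toPol f₂ (λ i → independent (coefficients f₂ (negate f₁)) combination i zero))
      where
      combination : lincomb (coefficients f₂ (negate f₁)) (family n α v₁ v₂) ≈ 0#
      combination = begin
        lincomb (coefficients f₂ (negate f₁)) (family n α v₁ v₂) ≈⟨ lincomb-coefficients f₂ (negate f₁) v₁ v₂ ⟩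
        ⟦ f₂ ⟧ * v₁ + ⟦ negate f₁ ⟧ * v₂                        ≈⟨ +-cong (*-congˡ v₁≈) (*-congʳ (⟦negate⟧ f₁)) ⟩
        ⟦ f₂ ⟧ * (y * v₂) + - ⟦ f₁ ⟧ * v₂                       ≈⟨ solve 4 (λ a b y v → a :* (y :* v) :+ (:- b) :* v := (y :* a :- b) :* v)
                                                                    refl ⟦ f₂ ⟧ ⟦ f₁ ⟧ y v₂ ⟩
        (y * ⟦ f₂ ⟧ - ⟦ f₁ ⟧) * v₂                              ≈⟨ *-congʳ (x≈y⇒x∙y⁻¹≈ε y*f₂≈f₁) ⟩
        0# * v₂                                                 ≈⟨ zeroˡ v₂ ⟩
        0#                                                      ∎

    difference : Pol<n → Pol<n → Pol<n
    difference u w = toVec n (toPol u -P toPol w)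

    ⟦difference⟧ : ∀ u w → ⟦ difference u w ⟧ ≈ ⟦ u ⟧ - ⟦ w ⟧
    ⟦difference⟧ u w = trans (toVec-value (toPol u -P toPol w) (DegreeBelow-−P (DegreeBelow-toPol u) (DegreeBelow-toPol w)))
                             (eval-−P (toPol u) (toPol w))

    difference-zero : ∀ u w → IsZero (toPol (difference u w)) → u ≈V w
    difference-zero u w z k = K.x∙y⁻¹≈ε⇒x≈y _ _ (K.trans (K.sym (coeff-−P (toPol u) (toPol w) k))
      (K.trans (K.sym (toPol-toVec n _ (DegreeBelow-−P (DegreeBelow-toPol u) (DegreeBelow-toPol w)) k)) (z k)))

    module _ {v₂ y} (v₂≉0 : NonZero v₂) (¬exc : ¬ Exceptional y) where
      combine : Pol<n × Pol<n → Carrier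
      combine (u₀ , u₁) = ⟦ u₀ ⟧ * (y * v₂) + ⟦ u₁ ⟧ * v₂

      combine≈0 : ∀ u₀ u₁ → combine (u₀ , u₁) ≈ 0# → IsZero (toPol u₀) × IsZero (toPol u₁)
      combine≈0 u₀ u₁ e = unexceptional-independent ¬exc u₀ u₁ (x*y≈0⇒y≈0 v₂≉0 (begin
        v₂ * (⟦ u₀ ⟧ * y + ⟦ u₁ ⟧)   ≈⟨ solve 4 (λ v a y b → v :* (a :* y :+ b) := a :* (y :* v) :+ b :* v) refl v₂ ⟦ u₀ ⟧ y ⟦ u₁ ⟧ ⟩
        combine (u₀ , u₁)            ≈⟨ e ⟩
        0#                           ∎))

      combine-injective : ∀ u w → combine u ≈ combine w → Pointwise _≈V_ _≈V_ u w
      combine-injective (u₀ , u₁) (w₀ , w₁) e =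
        let (d₀≈0 , d₁≈0) = combine≈0 (difference u₀ w₀) (difference u₁ w₁) (begin
              ⟦ difference u₀ w₀ ⟧ * (y * v₂) + ⟦ difference u₁ w₁ ⟧ * v₂
                ≈⟨ +-cong (*-congʳ (⟦difference⟧ u₀ w₀)) (*-congʳ (⟦difference⟧ u₁ w₁)) ⟩
              (⟦ u₀ ⟧ - ⟦ w₀ ⟧) * (y * v₂) + (⟦ u₁ ⟧ - ⟦ w₁ ⟧) * v₂
                ≈⟨ solve 6 (λ a b c d Y V → (a :- b) :* Y :+ (c :- d) :* V := (a :* Y :+ c :* V) :- (b :* Y :+ d :* V))
                     refl ⟦ u₀ ⟧ ⟦ w₀ ⟧ ⟦ u₁ ⟧ ⟦ w₁ ⟧ (y * v₂) v₂ ⟩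
              combine (u₀ , u₁) - combine (w₀ , w₁)
                ≈⟨ x≈y⇒x∙y⁻¹≈ε e ⟩
              0# ∎) in
        difference-zero u₀ w₀ d₀≈0 , difference-zero u₁ w₁ d₁≈0

      unexceptional⇒good : Good (y * v₂) v₂
      unexceptional⇒good = independent , spanning
        where
        independent : ∀ c → lincomb c (family n α (y * v₂) v₂) ≈ 0# → ∀ i j → c i j K.≈ K.0#
        independent c e i j = ≡.subst (K._≈ K.0#) (VecP.lookup∘tabulate (λ i → c i j) i)
          (≡.subst (K._≈ K.0#) (coeff-toPol (column c j) i) (column≈0 j (toℕ i)))
          where
          columns≈0 = combine≈0 (column c zero) (column c (suc zero)) (trans (sym (lincomb-family c (y * v₂) v₂)) e)
          column≈0 : ∀ j → IsZero (toPol (column c j))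
          column≈0 zero       = proj₁ columns≈0
          column≈0 (suc zero) = proj₂ columns≈0
        Q≡ : Q ≡ q ^ n ℕ.* q ^ n
        Q≡ = ≡.trans (≡.cong (q ^_) (≡.sym n+n≡2n)) (ℕP.^-distribˡ-+-* q n n)
        spanning : ∀ x → Σ _ λ c → lincomb c (family n α (y * v₂) v₂) ≈ x
        spanning x =
          let ((u₀ , u₁) , _ , combine≈x) = Counting.injective⇒surjective _≈_ isEquivalence pairCount
                (≡.subst (HasCount _≈_ (λ _ → ⊤)) Q≡ L-card) _≟_ combine (λ u w _ _ → combine-injective u w) x in
          coefficients u₀ u₁ , trans (lincomb-coefficients u₀ u₁ (y * v₂) v₂) combine≈x

    private
      open module C = Counting _≈_ isEquivalence using (HasCount-partition; HasCount-unique; HasCount-⇔; HasCount-singleton)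

      zero? : ∀ y → Dec (y ≈ 0#)
      zero? y = y ≟ 0#

      ≈0-resp : ∀ {x y} → x ≈ y → x ≈ 0# → y ≈ 0#
      ≈0-resp x≈y x≈0 = trans (sym x≈y) x≈0

      zero-count : ∀ {U : Carrier → Set} {k} → (∀ {y} → y ≈ 0# → U y) → HasCount _≈_ (λ y → U y × y ≈ 0#) k → k ≡ 1
      zero-count {U} U-zero count = HasCount-unique count
        (HasCount-⇔ (HasCount-singleton 0#) (λ y y≈0 → U-zero y≈0 , y≈0) (λ _ → proj₂))

    nonZeroCount : ∃ λ b → HasCount _≈_ (λ y → ⊤ × NonZero y) b × Q ≡ 1 ℕ.+ b
    nonZeroCount with HasCount-partition L-card zero? ≈0-resp
    ... | a , b , zeros-count , nonZero-count , a+b≡Q =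
      b , nonZero-count , ≡.trans (≡.sym a+b≡Q) (≡.cong (ℕ._+ b) (zero-count (λ _ → tt) zeros-count))

    private
      num den : Fin ν → Pol<n
      num i = proj₁ (lookup pairs i)
      den i = proj₂ (lookup pairs i)

      den≉0 : ∀ i → NonZero ⟦ den i ⟧
      den≉0 i = ⟦⟧-nonZero (den i) (proj₁ (proj₂ (pairs-reduced i)))

    ratio : Fin ν → Carrier
    ratio i = ⟦ num i ⟧ * inv ⟦ den i ⟧ (den≉0 i)

    ratio-correct : ∀ i → ratio i * ⟦ den i ⟧ ≈ ⟦ num i ⟧
    ratio-correct i = trans (*-assoc _ _ _) (trans (*-congˡ (*-inverseˡ _ (den≉0 i))) (*-identityʳ _))

    ratio-injective : ∀ i j → ratio i ≈ ratio j → i ≡ j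
    ratio-injective i j e = pairs-distinct i j
      (Fraction.reduced-unique (num i) (den i) (⟦⟧-nonZero (num i) (proj₁ (pairs-reduced i))) (den≉0 i)
        (pairs-reduced i) (num j) (den j) (pairs-reduced j) (begin
          ⟦ num j ⟧ * ⟦ den i ⟧              ≈⟨ *-congʳ (ratio-correct j) ⟨
          (ratio j * ⟦ den j ⟧) * ⟦ den i ⟧  ≈⟨ *-congʳ (*-congʳ e) ⟨
          (ratio i * ⟦ den j ⟧) * ⟦ den i ⟧  ≈⟨ solve 3 (λ a b c → (a :* b) :* c := (a :* c) :* b) refl (ratio i) ⟦ den j ⟧ ⟦ den i ⟧ ⟩
          (ratio i * ⟦ den i ⟧) * ⟦ den j ⟧  ≈⟨ *-congʳ (ratio-correct i) ⟩
          ⟦ num i ⟧ * ⟦ den j ⟧              ∎))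

    exceptionalNonZeroCount : HasCount _≈_ (λ y → (⊤ × Exceptional y) × NonZero y) ν
    exceptionalNonZeroCount = C.HasCount-map {_≈B_ = _≡_} (HasCount-Fin ν) ratio (λ { ≡.refl → refl })
      (λ i _ → (tt , inj₂ (lookup pairs i , pairs-reduced i , ratio-correct i)) ,
               *-nonZero (⟦⟧-nonZero (num i) (proj₁ (pairs-reduced i))) (inv-nonZero _ (den≉0 i)))
      (λ i j _ _ → ratio-injective i j)
      onto
      where
      onto : ∀ y → (⊤ × Exceptional y) × NonZero y → Σ (Fin ν) λ i → ⊤ × ratio i ≈ y
      onto y ((_ , inj₁ y≈0) , y≉0) = ⊥-elim (y≉0 y≈0)
      onto y ((_ , inj₂ ((f₁ , f₂) , f-reduced , y*f₂≈f₁)) , _) =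
        let (i , f₁≈ , f₂≈) = pairs-cover (f₁ , f₂) f-reduced in
        i , tt , *-cancelʳ (den≉0 i) (begin
          ratio i * ⟦ den i ⟧    ≈⟨ ratio-correct i ⟩
          ⟦ num i ⟧              ≈⟨ eval-cong (toPol f₁) (toPol (num i)) f₁≈ ⟨
          ⟦ f₁ ⟧                 ≈⟨ y*f₂≈f₁ ⟨
          y * ⟦ f₂ ⟧             ≈⟨ *-congˡ (eval-cong (toPol f₂) (toPol (den i)) f₂≈) ⟩
          y * ⟦ den i ⟧          ∎)

    unexceptionalCount : ∃ λ γ → HasCount _≈_ (λ y → ⊤ × ¬ Exceptional y) γ × Q ≡ (1 ℕ.+ ν) ℕ.+ γ
    unexceptionalCount with HasCount-partition L-card exceptional? Exceptional-resp
    ... | β , γ , exceptional-count , unexceptional-count , β+γ≡Q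
      with HasCount-partition exceptional-count zero? ≈0-resp
    ...   | β₀ , β₁ , zero-exceptional , nonZero-exceptional , β₀+β₁≡β =
      γ , unexceptional-count , ≡.trans (≡.sym β+γ≡Q) (≡.cong (ℕ._+ γ) (≡.trans (≡.sym β₀+β₁≡β)
        (≡.cong₂ ℕ._+_ (zero-count (λ y≈0 → tt , inj₁ y≈0) zero-exceptional)
                       (HasCount-unique nonZero-exceptional exceptionalNonZeroCount))))

    goodPairCount : ∀ {b γ} → HasCount _≈_ (λ y → ⊤ × NonZero y) b → HasCount _≈_ (λ y → ⊤ × ¬ Exceptional y) γ
                  → HasCount PairEq (GoodPair n α) (b ℕ.* γ)
    goodPairCount nonZero-count unexceptional-count =
      Counting.HasCount-map PairEq (×-isEquivalence isEquivalence isEquivalence) {_≈B_ = Pointwise _≈_ _≈_}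
        (HasCount-× {_≈A_ = _≈_} {_≈B_ = _≈_} nonZero-count unexceptional-count)
        (λ (v₂ , y) → y * v₂ , v₂) (λ (v₂≈ , y≈) → *-cong y≈ v₂≈ , v₂≈)
        (λ { (v₂ , y) ((_ , v₂≉0) , (_ , ¬exc)) → unexceptional⇒good v₂≉0 ¬exc })
        (λ { (v₂ , y) (v₂′ , y′) ((_ , v₂≉0) , _) _ (e₁ , e₂) → e₂ , *-cancelʳ v₂≉0 (trans e₁ (*-congˡ (sym e₂))) })
        onto
      where
      onto : ∀ v → GoodPair n α v → Σ (Carrier × Carrier) λ (v₂ , y) → ((⊤ × NonZero v₂) × (⊤ × ¬ Exceptional y)) × PairEq (y * v₂ , v₂) v
      onto (v₁ , v₂) good = (v₂ , y) , ((tt , v₂≉0) , (tt , good⇒unexceptional good (sym y*v₂≈v₁))) , y*v₂≈v₁ , refl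
        where
        v₂≉0 = good⇒nonZero good
        y = v₁ * inv v₂ v₂≉0
        y*v₂≈v₁ : y * v₂ ≈ v₁
        y*v₂≈v₁ = trans (*-assoc _ _ _) (trans (*-congˡ (*-inverseˡ v₂ v₂≉0)) (*-identityʳ v₁))

count-formula : ∀ {Q ν b γ} → Q ≡ 1 ℕ.+ b → Q ≡ (1 ℕ.+ ν) ℕ.+ γ
              → + (b ℕ.* γ) ≡ ((+ Q ℤ.- + ν) ℤ.- + 1) ℤ.* (+ Q ℤ.- + 1)
count-formula {ν = ν} {b} {γ} ≡.refl Q≡ = begin
  + (b ℕ.* γ)                                        ≡⟨ ℤP.pos-* b γ ⟩
  + b ℤ.* + γ                                        ≡⟨ ℤP.*-comm (+ b) (+ γ) ⟩
  + γ ℤ.* + b                                        ≡⟨ ≡.cong₂ ℤ._*_ (≡.trans (γ-identity (+ ν) (+ γ)) (≡.cong (λ Q → (+ Q ℤ.- + ν) ℤ.- + 1) (≡.sym Q≡)))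
                                                                       (b-identity (+ b)) ⟩
  ((+ (1 ℕ.+ b) ℤ.- + ν) ℤ.- + 1) ℤ.* (+ (1 ℕ.+ b) ℤ.- + 1) ∎
  where
  open ≡.≡-Reasoning
  open import Data.Integer.Tactic.RingSolver using (solve-∀)
  γ-identity : ∀ m g → g ≡ (((+ 1 ℤ.+ m) ℤ.+ g) ℤ.- m) ℤ.- + 1
  γ-identity = solve-∀
  b-identity : ∀ c → c ≡ (+ 1 ℤ.+ c) ℤ.- + 1
  b-identity = solve-∀

open import Data.Nat using (_*_)
open import Data.Integer using () renaming (_-_ to _-ℤ_; _*_ to _*ℤ_)

lemma3p2 : (q n : ℕ) → IsPrimePower q → 1 ≤ n
    → (K L : Field) → HasCard K q → HasCard L (q ^ (2 * n))
    → (ι : Field.Carrier K → Field.Carrier L)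
    → RingMorphisms.IsRingHomomorphism (Field.rawRing K) (Field.rawRing L) ι
    → (α : Field.Carrier L) → Extension.Generates K L ι α
    → (N ν : ℕ)
    → HasCount (Extension.PairEq K L ι) (Extension.GoodPair K L ι n α) N
    → HasCount (Poly.VecPairEq K {n}) (Poly.NuPair K {n}) ν
    → + N ≡ ((+ (q ^ (2 * n)) -ℤ + ν) -ℤ + 1) *ℤ (+ (q ^ (2 * n)) -ℤ + 1)
lemma3p2 q (suc n′) _ (s≤s z≤n) K L K-card L-card ι ι-hom α α-generates N ν N-count ν-count =
  let (b , nonZero , Q≡1+b) = nonZeroCount
      (γ , unexceptional , Q≡1+ν+γ) = unexceptionalCount in
  ≡.trans (≡.cong +_ (Counting.HasCount-unique PairEq (×-isEquivalence L.isEquivalence L.isEquivalence)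
                        N-count (goodPairCount nonZero unexceptional)))
          (count-formula Q≡1+b Q≡1+ν+γ)
  where
  module L = Field L
  open Extension K L ι using (PairEq)
  open FiniteExtension q n′ K L K-card L-card ι ι-hom α α-generates
  open GoodPairs ν ν-count
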